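{- Let $T$ be a tree with vertex set $\{v_1,\ldots,v_n\}$ and let $T^e$ be an arbitrary orientation of $T$. Let $D$ be the following orientation of $C_4\times T$: take four copies $T_1,T_2,T_3,T_4$ of $T$, with vertices $v_j^{(k)}$ ($1\le j\le n$, $1\le k\le 4$) corresponding to $v_j$; orient $T_1$ and $T_4$ as $T^e$ and orient $T_2$ and $T_3$ as the converse of $T^e$ (every arc reversed); and for each $j$ add the arcs $v_j^{(1)}\to v_j^{(2)}$, $v_j^{(1)}\to v_j^{(3)}$, $v_j^{(2)}\to v_j^{(4)}$, $v_j^{(4)}\to v_j^{(3)}$. (The underlying graph is $C_4\times T$, with the copies arranged in the 4-cycle $T_1,T_2,T_4,T_3$.) Then $D$ is a Pfaffian orientation of $C_4\times T$.
   Context: All graphs are finite and simple. $C_4$ is the cycle with 4 vertices and $G\times H$ is the Cartesian product of graphs. A cycle $C$ of a graph $G$ is nice if $G-C$ (the subgraph induced by the vertices not on $C$) has a perfect matching. If $D$ is an orientation of $G$ and $C$ is a cycle of even length, $C$ is oddly oriented in $D$ if, for either direction of traversal of $C$, an odd number of edges of $C$ are directed in $D$ along that direction. An orientation $D$ of $G$ is a Pfaffian orientation if every nice cycle of even length of $G$ is oddly oriented in $D$. -}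

module Defs where

open import Data.Nat using (ℕ; zero; suc; _+_; _%_)
open import Data.Nat.DivMod using (_mod_)
open import Data.Bool using (Bool; true; false; _∧_; _∨_; _xor_; not; if_then_else_)
open import Data.Fin using (Fin; toℕ) renaming (zero to f0; suc to fs)
open import Data.Fin.Properties using () renaming (_≟_ to _≟ᶠ_)
open import Data.Product using (Σ; _×_; _,_; ∃)
open import Data.Empty using (⊥)
open import Relation.Nullary using (¬_; does)
open import Relation.Binary.PropositionalEquality using (_≡_; _≢_)

Graph : Set → Set
Graph V = V → V → Bool

record IsSimple {V : Set} (G : Graph V) : Set where
  field
    sym     : ∀ u v → G u v ≡ G v u
    irrefl  : ∀ v → G v v ≡ false

Orientation : Set → Set
Orientation V = V → V → Bool

record IsOrientation {V : Set} (G : Graph V) (D : Orientation V) : Set where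
  field
    arc⇒edge : ∀ u v → D u v ≡ true → G u v ≡ true
    edge⇒one : ∀ u v → G u v ≡ true → (D u v xor D v u) ≡ true

converse : {V : Set} → Orientation V → Orientation V
converse D u v = D v u

next : ∀ {k} → Fin (suc k) → Fin (suc k)
next {k} i = (suc (toℕ i)) mod (suc k)

record Cycle {V : Set} (G : Graph V) : Set where
  field
    k      : ℕ                      -- the cycle has length k + 3
    vtx    : Fin (suc (suc (suc k))) → V
    inj    : ∀ i j → vtx i ≡ vtx j → i ≡ j
    adj    : ∀ i → G (vtx i) (vtx (next i)) ≡ true

  len : ℕ
  len = suc (suc (suc k))

  OnC : V → Set
  OnC v = ∃ λ i → vtx i ≡ v

open Cycle public

Even Odd : ℕ → Set
Even n = n % 2 ≡ 0
Odd  n = n % 2 ≡ 1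

EvenCycle : {V : Set} {G : Graph V} → Cycle G → Set
EvenCycle C = Even (len C)

-- G - S has a perfect matching, where S is the set of vertices not in
-- the predicate "NotIn": a perfect matching of the induced subgraph on
-- the remaining vertices, given as the partner map (each remaining
-- vertex v is matched to μ v, adjacent to v, with μ (μ v) = v).
HasPerfectMatchingOutside : {V : Set} → Graph V → (V → Set) → Set
HasPerfectMatchingOutside {V} G S =
  Σ (V → V) λ μ → ∀ v → ¬ S v →
     (¬ S (μ v)) × (G v (μ v) ≡ true) × (μ (μ v) ≡ v)

Nice : {V : Set} {G : Graph V} → Cycle G → Set
Nice {G = G} C = HasPerfectMatchingOutside G (OnC C)

count : ∀ {m} → (Fin m → Bool) → ℕ
count {zero}  f = 0
count {suc m} f = (if f f0 then 1 else 0) + count (λ i → f (fs i))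

OddlyOriented : {V : Set} {G : Graph V} → Orientation V → Cycle G → Set
OddlyOriented D C =
  Odd (count (λ i → D (vtx C i) (vtx C (next i)))) ×
  Odd (count (λ i → D (vtx C (next i)) (vtx C i)))

record IsPfaffian {V : Set} (G : Graph V) (D : Orientation V) : Set where
  field
    orientation : IsOrientation G D
    oddly       : (C : Cycle G) → EvenCycle C → Nice C → OddlyOriented D C

data Walk {V : Set} (G : Graph V) : V → V → Set where
  here : ∀ {u} → Walk G u u
  step : ∀ {u w v} → G u w ≡ true → Walk G w v → Walk G u v

record IsTree {V : Set} (G : Graph V) : Set where
  field
    simple    : IsSimple G
    connected : ∀ u v → Walk G u v
    acyclic   : Cycle G → ⊥

-- C4 and the Cartesian product C4 × T.
-- The copy index k ∈ Fin 4 stands for T_(k+1); the copies are arranged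
-- in the 4-cycle T1, T2, T4, T3, i.e. edges {0,1}, {1,3}, {3,2}, {2,0}.

c4arc : Fin 4 → Fin 4 → Bool  -- the arcs T1→T2, T1→T3, T2→T4, T4→T3
c4arc f0 (fs f0) = true
c4arc f0 (fs (fs f0)) = true
c4arc (fs f0) (fs (fs (fs f0))) = true
c4arc (fs (fs (fs f0))) (fs (fs f0)) = true
c4arc _ _ = false

C4 : Graph (Fin 4)
C4 a b = c4arc a b ∨ c4arc b a

C4×_ : ∀ {n} → Graph (Fin n) → Graph (Fin 4 × Fin n)
(C4× T) (a , x) (b , y) =
  (C4 a b ∧ does (x ≟ᶠ y)) ∨ (does (a ≟ᶠ b) ∧ T x y)

copyOrient : ∀ {n} → Orientation (Fin n) → Fin 4 → Orientation (Fin n)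
copyOrient Te f0 = Te
copyOrient Te (fs f0) = converse Te
copyOrient Te (fs (fs f0)) = converse Te
copyOrient Te (fs (fs (fs f0))) = Te

orientD : ∀ {n} → Orientation (Fin n) → Orientation (Fin 4 × Fin n)
orientD Te (a , x) (b , y) =
  (does (a ≟ᶠ b) ∧ copyOrient Te a x y) ∨ (c4arc a b ∧ does (x ≟ᶠ y))

-- Fix a set A of vertices of the tree and consider cycles C of C4 × T lying over A such that the
-- rest of the fibers over A has a perfect matching; by induction on |A| + |C| every such cycle has
-- an odd number of forward arcs (for an even cycle the other direction then follows). Take a leaf y
-- of A and let x be its neighbour in A.
--  * If C avoids the fiber over y, remove y from A: the copies of x matched into that fiber come in
--    C4-adjacent pairs, which are matched to each other instead.
--  * If C lies in the fiber over y, it is that 4-cycle, which D orients oddly.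
--  * Otherwise C enters the fiber over y from the fiber over x, follows one, two or three rungs and
--    returns. Replacing this excursion by rungs over x shortens C without changing its parity: the two
--    tree arcs cancel because C4-adjacent copies carry opposite orientations of T, and the rungs are
--    compared through the oddly oriented fiber 4-cycle. The vertices left behind over y are matched
--    along rungs; after two rungs the fourth vertex of the fiber over y is matched to its copy over x,
--    which is therefore free to be used by the new cycle.

module Submission where

open import Defs
open import Algebra.Bundles using (CommutativeRing; CommutativeMonoid)
open import Data.Bool using (Bool; true; false; not; _xor_; _∨_; _∧_; if_then_else_)
open import Data.Bool.Properties
  using (∧-zeroʳ; ∧-identityʳ; ∨-identityʳ; xor-assoc; xor-comm; xor-same; xor-identityʳ; xor-∧-commutativeRing)
  renaming (_≟_ to _≟ᵇ_)
open import Data.Empty using (⊥; ⊥-elim)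
open import Data.Fin as Fin using (Fin; zero; suc; inject₁; fromℕ; toℕ)
open import Data.Fin.Properties
  using (_≟_; all?; any?; ¬∀⟶∃¬; pigeonhole; toℕ-injective; toℕ-inject₁; toℕ-fromℕ; toℕ-fromℕ<; toℕ<n)
open import Data.List using (List; []; _∷_; _++_; tabulate; length; [_])
open import Data.List.Membership.Propositional using (_∈_; _∉_; find)
open import Data.List.Membership.Propositional.Properties using (∈-++⁺ˡ; ∈-++⁺ʳ; ∈-tabulate⁺; ∈-tabulate⁻)
open import Data.List.Relation.Unary.All as All using (All; []; _∷_)
open import Data.List.Relation.Unary.All.Properties as Allₚ using (All¬⇒¬Any; ¬Any⇒All¬; ¬All⇒Any¬)
open import Data.List.Relation.Unary.Any as Any using (Any; here; there)
open import Data.List.Relation.Unary.Unique.Propositional using (Unique; []; _∷_)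
open import Data.List.Relation.Unary.Unique.Propositional.Properties using (tabulate⁺)
open import Data.Nat as ℕ using (ℕ; zero; suc; _+_; _<_; _≤_; z≤n; s≤s; _%_)
open import Data.Nat.DivMod using (%-distribˡ-+; m<n⇒m%n≡m; n%n≡0)
open import Data.Nat.Properties
  using (suc-injective; +-comm; +-suc; +-identityʳ; +-monoˡ-<; +-monoʳ-<; <-cmp; <-irrefl; <⇒≤; <-≤-trans; ≤-pred;
         ≤∧≢⇒<; n<1+n; m≤n⇒m≤1+n; m<n⇒m<1+n; m<1+n⇒m<n∨m≡n; m≤n⇒∃[o]m+o≡n)
open import Data.Product using (Σ; ∃; ∃₂; _×_; _,_; proj₁; proj₂)
open import Data.Product.Properties using (≡-dec)
open import Data.Sum using (_⊎_; inj₁; inj₂)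
open import Function using (_∘_)
open import Level using (0ℓ)
open import Relation.Binary.Definitions using (DecidableEquality; tri<; tri≈; tri>)
open import Relation.Binary.PropositionalEquality
  using (_≡_; _≢_; refl; sym; trans; cong; cong₂; subst; setoid; module ≡-Reasoning)
open import Relation.Nullary using (¬_; Dec; yes; no; does)
open import Relation.Nullary.Decidable using (from-yes; _→-dec_; _×-dec_; _⊎-dec_; ¬?; dec-true; dec-false)
open import Relation.Nullary.Negation using (contradiction)
open import Relation.Unary using (Pred; Decidable)

xor-commutativeMonoid : CommutativeMonoid _ _
xor-commutativeMonoid = CommutativeRing.+-commutativeMonoid xor-∧-commutativeRing

open import Algebra.Properties.CommutativeMonoid.Sum xor-commutativeMonoid using (sum; sum-cong-≗; ∑-distrib-+)
open import Algebra.Solver.CommutativeMonoid xor-commutativeMonoid using (solve; _⊜_; _⊕_; id)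

xor-true : ∀ {p q} → p xor q ≡ true → q ≡ not p
xor-true {true}  {false} _ = refl
xor-true {false} {true}  _ = refl

∧-∨-true : ∀ {p q r s} → (p ∧ q) ∨ (r ∧ s) ≡ true → (p ≡ true × q ≡ true) ⊎ (r ≡ true × s ≡ true)
∧-∨-true {true}  {true}           _ = inj₁ (refl , refl)
∧-∨-true {true}  {false} {true}   e = inj₂ (refl , e)
∧-∨-true {false} {_}     {true}   e = inj₂ (refl , e)

does-true : ∀ {n} {x y : Fin n} → does (x ≟ y) ≡ true → x ≡ y
does-true {x = x} {y} e with x ≟ y
... | yes x≡y = x≡y

does-sym : ∀ {n} (x y : Fin n) → does (x ≟ y) ≡ does (y ≟ x)
does-sym x y with x ≟ y | y ≟ x
... | yes _   | yes _   = refl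
... | no _    | no _    = refl
... | yes x≡y | no y≢x  = contradiction (sym x≡y) y≢x
... | no x≢y  | yes y≡x = contradiction (sym y≡x) x≢y

bit : Bool → ℕ
bit b = if b then 1 else 0

suc-%2 : ∀ k b → k % 2 ≡ bit b → suc k % 2 ≡ bit (not b)
suc-%2 k b k%2 = begin
  (1 + k) % 2             ≡⟨ %-distribˡ-+ 1 k 2 ⟩
  (1 + k % 2) % 2         ≡⟨ cong (λ r → (1 + r) % 2) k%2 ⟩
  (1 + bit b) % 2         ≡⟨ lemma b ⟩
  bit (not b)             ∎
  where
  open ≡-Reasoning
  lemma : ∀ b → (1 + bit b) % 2 ≡ bit (not b)
  lemma true  = refl
  lemma false = refl

count-%2 : ∀ {m} (f : Fin m → Bool) → count f % 2 ≡ bit (sum f)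
count-%2 {zero}  f = refl
count-%2 {suc m} f with f zero
... | true  = suc-%2 (count (λ i → f (suc i))) (sum (λ i → f (suc i))) (count-%2 (λ i → f (suc i)))
... | false = count-%2 (λ i → f (suc i))

odd-count : ∀ {m} (f : Fin m → Bool) → sum f ≡ true → Odd (count f)
odd-count f s = trans (count-%2 f) (cong bit s)

sum-not : ∀ {m} → Even m → (f : Fin m → Bool) → sum (λ i → not (f i)) ≡ sum f
sum-not {m} even f = trans (∑-distrib-+ (λ _ → true) f) (cong (_xor sum f) sum-true)
  where
  count-true : ∀ m → count (λ (_ : Fin m) → true) ≡ m
  count-true zero    = refl
  count-true (suc m) = cong suc (count-true m)
  bit≡0 : ∀ {b} → bit b ≡ 0 → b ≡ false
  bit≡0 {false} _ = refl
  sum-true : sum (λ (_ : Fin m) → true) ≡ false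
  sum-true = bit≡0 (trans (sym (count-%2 (λ (_ : Fin m) → true))) (trans (cong (_% 2) (count-true m)) even))

count-mono : ∀ {m} {f g : Fin m → Bool} → (∀ i → f i ≡ true → g i ≡ true) → count f ≤ count g
count-mono {zero}  _ = z≤n
count-mono {suc m} {f} {g} f⇒g with f zero in fz | g zero in gz
... | true  | true  = s≤s (count-mono (λ i → f⇒g (suc i)))
... | true  | false = contradiction (trans (sym (f⇒g zero fz)) gz) λ ()
... | false | true  = m≤n⇒m≤1+n (count-mono (λ i → f⇒g (suc i)))
... | false | false = count-mono (λ i → f⇒g (suc i))

count-mono-< : ∀ {m} {f g : Fin m → Bool} → (∀ i → f i ≡ true → g i ≡ true) → ∀ j → f j ≡ false → g j ≡ true →
               count f < count g
count-mono-< {suc m} {f} {g} f⇒g zero    fj gj rewrite fj | gj = s≤s (count-mono (λ i → f⇒g (suc i)))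
count-mono-< {suc m} {f} {g} f⇒g (suc j) fj gj with f zero in fz | g zero in gz
... | true  | true  = s≤s (count-mono-< (λ i → f⇒g (suc i)) j fj gj)
... | true  | false = contradiction (trans (sym (f⇒g zero fz)) gz) λ ()
... | false | true  = m≤n⇒m≤1+n (count-mono-< (λ i → f⇒g (suc i)) j fj gj)
... | false | false = count-mono-< (λ i → f⇒g (suc i)) j fj gj

Unique-++-disjoint : ∀ {A : Set} {xs ys : List A} {x y} → Unique (xs ++ ys) → x ∈ xs → y ∈ ys → x ≢ y
Unique-++-disjoint {xs = _ ∷ xs} (x∉ ∷ _) (here refl) y∈ys = λ x≡y → All¬⇒¬Any x∉ (∈-++⁺ʳ xs (subst (_∈ _) (sym x≡y) y∈ys))
Unique-++-disjoint (_ ∷ u) (there x∈xs) y∈ys = Unique-++-disjoint u x∈xs y∈ys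

repeated-not-unique : ∀ {A : Set} (xs ys : List A) {v zs} → ¬ Unique (xs ++ v ∷ ys ++ v ∷ zs)
repeated-not-unique []       ys (v∉ ∷ _) = All¬⇒¬Any v∉ (∈-++⁺ʳ ys (here refl))
repeated-not-unique (_ ∷ xs) ys (_ ∷ u)  = repeated-not-unique xs ys u

Unique-drop : ∀ {A : Set} (ys : List A) {v zs} → Unique (ys ++ v ∷ zs) → Unique (ys ++ zs)
Unique-drop []       (_ ∷ u)   = u
Unique-drop (_ ∷ ys) (y∉ ∷ u) = All-drop y∉ ∷ Unique-drop ys u
  where
  All-drop : ∀ {P : _ → Set} {v zs} → All P (ys ++ v ∷ zs) → All P (ys ++ zs)
  All-drop ps with Allₚ.++⁻ ys ps
  ... | ps₁ , _ ∷ ps₂ = Allₚ.++⁺ ps₁ ps₂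

Unique-insert : ∀ {A : Set} (ys : List A) {v zs} → v ∉ ys ++ zs → Unique (ys ++ zs) → Unique (ys ++ v ∷ zs)
Unique-insert []       v∉ u         = ¬Any⇒All¬ _ v∉ ∷ u
Unique-insert (y ∷ ys) v∉ (y∉ ∷ u) = All-insert y∉ ∷ Unique-insert ys (v∉ ∘ there) u
  where
  All-insert : ∀ {zs} → All (y ≢_) (ys ++ zs) → All (y ≢_) (ys ++ _ ∷ zs)
  All-insert ps with Allₚ.++⁻ ys ps
  ... | ps₁ , ps₂ = Allₚ.++⁺ ps₁ ((λ y≡v → v∉ (here (sym y≡v))) ∷ ps₂)

∉-insert : ∀ {A : Set} (ys : List A) {v w zs} → v ∉ ys ++ zs → v ≢ w → v ∉ ys ++ w ∷ zs
∉-insert []       v∉ v≢w (here v≡w)  = v≢w v≡w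
∉-insert []       v∉ v≢w (there v∈)  = v∉ v∈
∉-insert (_ ∷ ys) v∉ v≢w (here v≡y)  = v∉ (here v≡y)
∉-insert (_ ∷ ys) v∉ v≢w (there v∈)  = ∉-insert ys (v∉ ∘ there) v≢w v∈

-- Walks

module Walks {V : Set} {G : Graph V} where

  private variable
    s t u v w : V

  vertices : Walk G u v → List V
  vertices here               = []
  vertices (step {u = u} _ p) = u ∷ vertices p

  infixr 5 _++ᵂ_
  _++ᵂ_ : Walk G u v → Walk G v w → Walk G u w
  here     ++ᵂ q = q
  step g p ++ᵂ q = step g (p ++ᵂ q)

  vertices-++ : (p : Walk G u v) (q : Walk G v w) → vertices (p ++ᵂ q) ≡ vertices p ++ vertices q
  vertices-++ here       q = refl
  vertices-++ (step g p) q = cong (_ ∷_) (vertices-++ p q)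

  ++ᵂ-assoc : (p : Walk G s t) (q : Walk G t u) (r : Walk G u v) → (p ++ᵂ q) ++ᵂ r ≡ p ++ᵂ (q ++ᵂ r)
  ++ᵂ-assoc here       q r = refl
  ++ᵂ-assoc (step g p) q r = cong (step g) (++ᵂ-assoc p q r)

  record Departure (t : V) (p : Walk G u v) : Set where
    field
      {to}   : V
      before : Walk G u t
      edge   : G t to ≡ true
      after  : Walk G to v
      split  : before ++ᵂ step edge after ≡ p

  departure : (p : Walk G u v) → t ∈ vertices p → Departure t p
  departure (step g p) (here refl) = record { before = here ; edge = g ; after = p ; split = refl }
  departure (step g p) (there t∈) =
    record { Departure d ; before = step g (Departure.before d) ; split = cong (step g) (Departure.split d) }
    where d = departure p t∈

  last-step : (g : G u w ≡ true) (p : Walk G w t) → ∃ λ s → s ∈ vertices (step g p) × G s t ≡ true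
  last-step g here        = _ , here refl , g
  last-step g (step h p) with last-step h p
  ... | s , s∈ , gs = s , there s∈ , gs

  source-∈⊎end : (p : Walk G u v) → u ∈ vertices p ⊎ u ≡ v
  source-∈⊎end here       = inj₂ refl
  source-∈⊎end (step g p) = inj₁ (here refl)

  neighbours-on-walk : (p : Walk G u v) → Unique (vertices p) → t ∈ vertices p → t ≢ u →
                       ∃₂ λ r s → r ∈ vertices p × G r t ≡ true × G t s ≡ true × ((s ∈ vertices p × r ≢ s) ⊎ s ≡ v)
  neighbours-on-walk p uniq t∈ t≢u with departure p t∈
  ... | record { before = here } = contradiction refl t≢u
  ... | record { before = step g b ; edge = e ; after = a ; split = refl }
    rewrite vertices-++ (step g b) (step e a) with last-step g b | source-∈⊎end a
  ...   | r , r∈ , gr | inj₂ s≡v = r , _ , ∈-++⁺ˡ r∈ , gr , e , inj₂ s≡v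
  ...   | r , r∈ , gr | inj₁ s∈ = r , _ , ∈-++⁺ˡ r∈ , gr , e ,
          inj₁ (∈-++⁺ʳ (vertices (step g b)) (there s∈) , Unique-++-disjoint uniq r∈ (there s∈))

  module _ {p} {P : Pred V p} (P? : Decidable P) where

    record Crossing (c : Walk G u v) : Set p where
      field
        {from to} : V
        before    : Walk G u from
        edge      : G from to ≡ true
        after     : Walk G to v
        ¬Pfrom    : ¬ P from
        Pto       : P to
        split     : before ++ᵂ step edge after ≡ c

    private
      prepend : (g : G u w ≡ true) {c : Walk G w v} → Crossing c → Crossing (step g c)
      prepend g x = record { Crossing x ; before = step g (Crossing.before x) ; split = cong (step g) (Crossing.split x) }

      append : {c : Walk G u v} → Crossing c → (d : Walk G v w) → Crossing (c ++ᵂ d)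
      append x d = record { Crossing x ; after = Crossing.after x ++ᵂ d
                          ; split = trans (sym (++ᵂ-assoc (Crossing.before x) _ d)) (cong (_++ᵂ d) (Crossing.split x)) }

    crossing : (c : Walk G u v) → P v → Any (λ x → ¬ P x) (vertices c) → Crossing c
    crossing (step {w = w} g c) Pv ¬P∈ with P? w
    crossing (step g c) Pv (here ¬Pu)  | yes Pw =
      record { before = here ; edge = g ; after = c ; ¬Pfrom = ¬Pu ; Pto = Pw ; split = refl }
    crossing (step g c) Pv (there ¬P∈) | yes Pw = prepend g (crossing c Pv ¬P∈)
    crossing (step g c) Pv _           | no ¬Pw with source-∈⊎end c
    ... | inj₁ w∈ = prepend g (crossing c Pv (Any.map (λ { refl → ¬Pw }) w∈))
    ... | inj₂ refl = contradiction Pv ¬Pw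

    crossing-closed : (c : Walk G u u) → Any P (vertices c) → Any (λ x → ¬ P x) (vertices c) → Crossing c
    crossing-closed {u} c P∈ ¬P∈ with P? u
    ... | yes Pu = crossing c Pu ¬P∈
    ... | no ¬Pu with find P∈
    ...   | t , t∈ , Pt with departure c t∈
    ...     | record { before = b ; edge = e ; after = a ; split = refl } with source-∈⊎end b
    ...       | inj₂ refl = contradiction Pt ¬Pu
    ...       | inj₁ u∈ = append (crossing b Pt (Any.map (λ { refl → ¬Pu }) u∈)) (step e a)

  path : ∀ {m} (f : Fin (suc m) → V) → (∀ j → G (f (inject₁ j)) (f (suc j)) ≡ true) → G (f (fromℕ m)) t ≡ true →
         Walk G (f zero) t
  path {m = zero}  f adj close = step close here
  path {m = suc m} f adj close = step (adj zero) (path (λ i → f (suc i)) (λ j → adj (suc j)) close)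

  vertices-path : ∀ {m} (f : Fin (suc m) → V) adj (close : G (f (fromℕ m)) t ≡ true) →
                  vertices (path f adj close) ≡ tabulate f
  vertices-path {m = zero}  f adj close = refl
  vertices-path {m = suc m} f adj close = cong (f zero ∷_) (vertices-path (λ i → f (suc i)) (λ j → adj (suc j)) close)

  module _ (D : Orientation V) where

    parity : Walk G u v → Bool
    parity here                       = false
    parity (step {u = u} {w = w} _ p) = D u w xor parity p

    parity-++ : (p : Walk G u v) (q : Walk G v w) → parity (p ++ᵂ q) ≡ parity p xor parity q
    parity-++ here                       q = refl
    parity-++ (step {u = u} {w = w} g p) q =
      trans (cong (D u w xor_) (parity-++ p q)) (sym (xor-assoc (D u w) (parity p) (parity q)))

    parity-prefix : (e e′ : Walk G s t) (r : Walk G t u) → parity e ≡ parity e′ → parity (e ++ᵂ r) ≡ parity (e′ ++ᵂ r)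
    parity-prefix e e′ r e≡e′ = trans (parity-++ e r) (trans (cong (_xor parity r) e≡e′) (sym (parity-++ e′ r)))

    parity-path : ∀ {m} (f : Fin (suc m) → V) adj (close : G (f (fromℕ m)) t ≡ true) (F : Fin (suc m) → Bool) →
                  (∀ j → F (inject₁ j) ≡ D (f (inject₁ j)) (f (suc j))) → F (fromℕ m) ≡ D (f (fromℕ m)) t →
                  parity (path f adj close) ≡ sum F
    parity-path {m = zero}  f adj close F Finner Flast = cong (_xor false) (sym Flast)
    parity-path {m = suc m} f adj close F Finner Flast =
      cong₂ _xor_ (sym (Finner zero))
                  (parity-path (λ i → f (suc i)) (λ j → adj (suc j)) close (λ i → F (suc i)) (λ j → Finner (suc j)) Flast)

-- Perfect matchings

IsPerfectMatchingOn : {V : Set} → Graph V → (V → Set) → (V → V) → Set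
IsPerfectMatchingOn G F μ = ∀ v → F v → F (μ v) × G v (μ v) ≡ true × μ (μ v) ≡ v

module Matchings {V : Set} {G : Graph V} (G-sym : ∀ u v → G u v ≡ G v u)
                 (_≟_ : DecidableEquality V) where

  open import Data.List.Relation.Binary.Permutation.Setoid (setoid V) using (_↭_; ↭-sym)
  open import Data.List.Relation.Binary.Permutation.Setoid.Properties (setoid V) using (shifts; ∈-resp-↭; Unique-resp-↭)

  Free : (V → Set) → List V → V → Set
  Free R l v = R v × v ∉ l

  matching-resp : ∀ {F F' μ} → (∀ {v} → F' v → F v) → (∀ {v} → F v → F' v) →
                  IsPerfectMatchingOn G F μ → IsPerfectMatchingOn G F' μ
  matching-resp F'⇒F F⇒F' m v Fv with m v (F'⇒F Fv)
  ... | Fμv , g , inv = F⇒F' Fμv , g , inv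

  matching-resp-↭ : ∀ {R l l' μ} → l ↭ l' → IsPerfectMatchingOn G (Free R l) μ → IsPerfectMatchingOn G (Free R l') μ
  matching-resp-↭ l↭l' = matching-resp (λ (Rv , v∉l') → Rv , λ v∈l → v∉l' (∈-resp-↭ l↭l' v∈l))
                                         (λ (Rv , v∉l) → Rv , λ v∈l' → v∉l (∈-resp-↭ (↭-sym l↭l') v∈l'))

  pair-up : V → V → (V → V) → V → V
  pair-up p q μ v with v ≟ p | v ≟ q
  ... | yes _ | _     = q
  ... | no _  | yes _ = p
  ... | no _  | no _  = μ v

  pair-up-p : ∀ p q μ → pair-up p q μ p ≡ q
  pair-up-p p q μ with p ≟ p
  ... | yes _  = refl
  ... | no p≢p = contradiction refl p≢p

  pair-up-q : ∀ {p q} μ → p ≢ q → pair-up p q μ q ≡ p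
  pair-up-q {p} {q} μ p≢q with q ≟ p | q ≟ q
  ... | yes q≡p | _      = contradiction (sym q≡p) p≢q
  ... | no _    | yes _  = refl
  ... | no _    | no q≢q = contradiction refl q≢q

  pair-up-other : ∀ {p q} μ {v} → v ≢ p → v ≢ q → pair-up p q μ v ≡ μ v
  pair-up-other {p} {q} μ {v} v≢p v≢q with v ≟ p | v ≟ q
  ... | yes v≡p | _       = contradiction v≡p v≢p
  ... | no _    | yes v≡q = contradiction v≡q v≢q
  ... | no _    | no _    = refl

  private
    uncover-front : ∀ {R p q l μ} → Unique (p ∷ q ∷ l) → R p → R q → G p q ≡ true →
                    IsPerfectMatchingOn G (Free R (p ∷ q ∷ l)) μ → IsPerfectMatchingOn G (Free R l) (pair-up p q μ)
    uncover-front {R} {p} {q} {l} {μ} ((p≢q ∷ p∉l) ∷ q∉l ∷ _) Rp Rq g m v (Rv , v∉l) with v ≟ p | v ≟ q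
    ... | yes refl | _ = (Rq , All¬⇒¬Any q∉l) , g , pair-up-q μ p≢q
    ... | no v≢p | yes refl = (Rp , All¬⇒¬Any p∉l) , trans (G-sym q p) g , pair-up-p p q μ
    ... | no v≢p | no v≢q
      with m v (Rv , λ { (here v≡p) → v≢p v≡p ; (there (here v≡q)) → v≢q v≡q ; (there (there v∈l)) → v∉l v∈l })
    ...   | (Rμv , μv∉) , gμ , inv = (Rμv , λ μv∈l → μv∉ (there (there μv∈l))) , gμ ,
            trans (pair-up-other μ (λ e → μv∉ (here e)) (λ e → μv∉ (there (here e)))) inv

    cover-front : ∀ {R l μ v} → IsPerfectMatchingOn G (Free R l) μ → Free R l v →
                  IsPerfectMatchingOn G (Free R (v ∷ μ v ∷ l)) μ
    cover-front {μ = μ} {v} m Fv z (Rz , z∉) with m z (Rz , z∉ ∘ there ∘ there) | m v Fv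
    ... | (Rμz , μz∉l) , g , inv | _ , _ , invᵥ = (Rμz , μz∉) , g , inv
      where
      μz∉ : μ z ∉ v ∷ μ v ∷ _
      μz∉ (here μz≡v)           = z∉ (there (here (trans (sym inv) (cong μ μz≡v))))
      μz∉ (there (here μz≡μv)) = z∉ (here (trans (sym inv) (trans (cong μ μz≡μv) invᵥ)))
      μz∉ (there (there μz∈l))  = μz∉l μz∈l

  uncover : ∀ {R p q} ys {zs μ} → Unique (ys ++ p ∷ q ∷ zs) → R p → R q → G p q ≡ true →
            IsPerfectMatchingOn G (Free R (ys ++ p ∷ q ∷ zs)) μ → IsPerfectMatchingOn G (Free R (ys ++ zs)) (pair-up p q μ)
  uncover {p = p} {q} ys uniq Rp Rq g m =
    uncover-front (Unique-resp-↭ to-front uniq) Rp Rq g (matching-resp-↭ to-front m)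
    where
    to-front = shifts ys (p ∷ q ∷ [])

  cover : ∀ {R v} ys {zs μ} → IsPerfectMatchingOn G (Free R (ys ++ zs)) μ → Free R (ys ++ zs) v →
          IsPerfectMatchingOn G (Free R (ys ++ v ∷ μ v ∷ zs)) μ
  cover {v = v} ys {μ = μ} m Fv = matching-resp-↭ (↭-sym (shifts ys (v ∷ μ v ∷ []))) (cover-front m Fv)

-- Leaves of forests

toℕ-next-< : ∀ {k} (i : Fin (suc k)) → suc (toℕ i) < suc k → toℕ (next i) ≡ suc (toℕ i)
toℕ-next-< i lt = trans (toℕ-fromℕ< _) (m<n⇒m%n≡m lt)

next-last : ∀ {k} (i : Fin (suc k)) → toℕ i ≡ k → next i ≡ zero
next-last {k} i i≡k = toℕ-injective (trans (toℕ-fromℕ< _) (trans (cong (λ m → suc m % suc k) i≡k) (n%n≡0 (suc k))))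

next-inject₁ : ∀ {m} (j : Fin m) → next (inject₁ j) ≡ suc j
next-inject₁ j = toℕ-injective (trans (toℕ-next-< (inject₁ j) (s≤s (subst (_< _) (sym (toℕ-inject₁ j)) (toℕ<n j))))
                                      (cong suc (toℕ-inject₁ j)))

next-fromℕ : ∀ m → next (fromℕ m) ≡ zero
next-fromℕ m = next-last (fromℕ m) (toℕ-fromℕ m)

LeafIn : ∀ {n} → Graph (Fin n) → (Fin n → Bool) → Fin n → Set
LeafIn T A y = ∀ z z' → A z ≡ true → A z' ≡ true → T y z ≡ true → T y z' ≡ true → z ≡ z'

module _ {n} {T : Graph (Fin n)} (irrefl : ∀ x → T x x ≡ false) (acyclic : Cycle T → ⊥) where

  stretch-cycle : (u : ℕ → Fin n) (i k : ℕ) → (∀ m → T (u m) (u (suc m)) ≡ true) →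
                  (∀ {a b} → a < b → b < 3 + k → u (i + a) ≢ u (i + b)) → u (i + (3 + k)) ≡ u i → Cycle T
  stretch-cycle u i k u-adj distinct closes = record { k = k ; vtx = vt ; inj = vt-injective ; adj = vt-adjacent }
    where
    vt : Fin (3 + k) → Fin n
    vt t = u (i + toℕ t)
    vt-injective : ∀ s t → vt s ≡ vt t → s ≡ t
    vt-injective s t e with <-cmp (toℕ s) (toℕ t)
    ... | tri< s<t _ _ = contradiction e (distinct s<t (toℕ<n t))
    ... | tri≈ _ s≡t _ = toℕ-injective s≡t
    ... | tri> _ _ t<s = contradiction (sym e) (distinct t<s (toℕ<n s))
    vt-adjacent : ∀ t → T (vt t) (vt (next t)) ≡ true
    vt-adjacent t with toℕ t ℕ.≟ 2 + k
    ... | yes t≡last rewrite next-last t t≡last | +-identityʳ i =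
          subst (λ v → T (vt t) v ≡ true) closes
            (subst (λ m → T (vt t) (u m) ≡ true) (trans (sym (+-suc i (toℕ t))) (cong (λ m → i + suc m) t≡last))
                   (u-adj (i + toℕ t)))
    ... | no t≢last rewrite toℕ-next-< t (s≤s (≤∧≢⇒< (≤-pred (toℕ<n t)) t≢last)) | +-suc i (toℕ t) = u-adj (i + toℕ t)

  -- The first repetition of a non-backtracking walk would close a cycle.
  non-backtracking-injective : (u : ℕ → Fin n) → (∀ m → T (u m) (u (suc m)) ≡ true) → (∀ m → u (2 + m) ≢ u m) →
                              ∀ {i j} → i < j → u i ≢ u j
  non-backtracking-injective u u-adj no-backtrack i<j = distinct-below (suc _) i<j (n<1+n _)
    where
    no-return : ∀ i o → i < i + o → (∀ {a b} → a < b → b < i + o → u a ≢ u b) → u i ≢ u (i + o)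
    no-return i 0 i<i+0 _ _ = <-irrefl (sym (+-identityʳ i)) i<i+0
    no-return i 1 _ _ e = contradiction (trans (sym loop) (irrefl (u i))) λ ()
      where
      loop : T (u i) (u i) ≡ true
      loop = subst (λ v → T (u i) v ≡ true) (trans (cong u (+-comm 1 i)) (sym e)) (u-adj i)
    no-return i 2 _ _ e = no-backtrack i (trans (cong u (+-comm 2 i)) (sym e))
    no-return i (suc (suc (suc k))) _ distinct e =
      acyclic (stretch-cycle u i k u-adj (λ a<b b<L → distinct (+-monoʳ-< i a<b) (+-monoʳ-< i b<L)) (sym e))

    distinct-below : ∀ j {a b} → a < b → b < j → u a ≢ u b
    distinct-below (suc j) {a} a<b b<1+j with m<1+n⇒m<n∨m≡n b<1+j
    ... | inj₁ b<j = distinct-below j a<b b<j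
    ... | inj₂ refl with m≤n⇒∃[o]m+o≡n (<⇒≤ a<b)
    ...   | o , refl = no-return a o a<b (distinct-below j)

  private
    leafAt? : ∀ (A : Fin n → Bool) y z z' → Dec (A z ≡ true → A z' ≡ true → T y z ≡ true → T y z' ≡ true → z ≡ z')
    leafAt? A y z z' = (A z ≟ᵇ true) →-dec (A z' ≟ᵇ true) →-dec (T y z ≟ᵇ true) →-dec (T y z' ≟ᵇ true) →-dec (z ≟ z')

    leafIn? : ∀ (A : Fin n → Bool) y → Dec (LeafIn T A y)
    leafIn? A y = all? λ z → all? (leafAt? A y z)

    premise : ∀ {P Q : Set} → Dec P → ¬ (P → Q) → P × ¬ Q
    premise (yes p) ¬p→q = p , λ q → ¬p→q (λ _ → q)
    premise (no ¬p) ¬p→q = contradiction (λ p → contradiction p ¬p) ¬p→q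

  record Arc (A : Fin n → Bool) : Set where
    field
      {from to} : Fin n
      from∈A    : A from ≡ true
      to∈A      : A to ≡ true
      adjacent  : T from to ≡ true

  module _ (A : Fin n → Bool) (noLeaf : ∀ y → A y ≡ true → ¬ LeafIn T A y) where

    private
      two-neighbours : ∀ {y} → A y ≡ true →
                       ∃₂ λ z z' → A z ≡ true × A z' ≡ true × T y z ≡ true × T y z' ≡ true × z ≢ z'
      two-neighbours {y} Ay with ¬∀⟶∃¬ n _ (λ z → all? (leafAt? A y z)) (noLeaf y Ay)
      ... | z , ¬∀z' with ¬∀⟶∃¬ n _ (leafAt? A y z) ¬∀z'
      ...   | z' , ¬leaf₁ with premise (A z ≟ᵇ true) ¬leaf₁
      ...     | Az , ¬leaf₂ with premise (A z' ≟ᵇ true) ¬leaf₂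
      ...       | Az' , ¬leaf₃ with premise (T y z ≟ᵇ true) ¬leaf₃
      ...         | Tyz , ¬leaf₄ with premise (T y z' ≟ᵇ true) ¬leaf₄
      ...           | Tyz' , z≢z' = z , z' , Az , Az' , Tyz , Tyz' , z≢z'

      successor : (e : Arc A) → ∃ λ z → A z ≡ true × T (Arc.to e) z ≡ true × z ≢ Arc.from e
      successor e with two-neighbours (Arc.to∈A e)
      ... | z , z' , Az , Az' , Tz , Tz' , z≢z' with z ≟ Arc.from e
      ...   | yes z≡from = z' , Az' , Tz' , λ z'≡from → z≢z' (trans z≡from (sym z'≡from))
      ...   | no z≢from  = z , Az , Tz , z≢from

    onward : Arc A → Arc A
    onward e = record { from∈A = Arc.to∈A e ; to∈A = proj₁ (proj₂ (successor e))
                      ; adjacent = proj₁ (proj₂ (proj₂ (successor e))) }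

    no-leaf-contradiction : ∀ {z} → A z ≡ true → ⊥
    no-leaf-contradiction Az with two-neighbours Az
    ... | z′ , _ , Az′ , _ , Tzz′ , _ = repeats (pigeonhole (n<1+n n) (λ (i : Fin (suc n)) → u (toℕ i)))
      where
      arcs : ℕ → Arc A
      arcs zero    = record { from∈A = Az ; to∈A = Az′ ; adjacent = Tzz′ }
      arcs (suc m) = onward (arcs m)
      u : ℕ → Fin n
      u m = Arc.from (arcs m)
      repeats : (∃₂ λ i j → i Fin.< j × u (toℕ i) ≡ u (toℕ j)) → ⊥
      repeats (i , j , i<j , e) =
        non-backtracking-injective u (λ m → Arc.adjacent (arcs m)) (λ m → proj₂ (proj₂ (proj₂ (successor (arcs m))))) i<j e

  leaf-exists : ∀ A {z} → A z ≡ true → ∃ λ y → A y ≡ true × LeafIn T A y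
  leaf-exists A Az with any? (λ y → (A y ≟ᵇ true) ×-dec leafIn? A y)
  ... | yes found = found
  ... | no none   = ⊥-elim (no-leaf-contradiction A (λ y Ay leaf → none (y , Ay , leaf)) Az)

opp : Fin 4 → Fin 4
opp zero                   = suc (suc (suc zero))
opp (suc zero)             = suc (suc zero)
opp (suc (suc zero))       = suc zero
opp (suc (suc (suc zero))) = zero

C4-irrefl : ∀ a → C4 a a ≡ false
C4-irrefl = from-yes (all? λ a → C4 a a ≟ᵇ false)

c4arc-irrefl : ∀ a → c4arc a a ≡ false
c4arc-irrefl = from-yes (all? λ a → c4arc a a ≟ᵇ false)

C4-sym : ∀ a b → C4 a b ≡ C4 b a
C4-sym = from-yes (all? λ a → all? λ b → C4 a b ≟ᵇ C4 b a)

C4-other : ∀ a b c → C4 a b ≡ true → C4 b c ≡ true → c ≢ a → c ≡ opp a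
C4-other = from-yes (all? λ a → all? λ b → all? λ c →
  (C4 a b ≟ᵇ true) →-dec (C4 b c ≟ᵇ true) →-dec ¬? (c ≟ a) →-dec (c ≟ opp a))

c4arc-one : ∀ a b → C4 a b ≡ true → c4arc a b xor c4arc b a ≡ true
c4arc-one = from-yes (all? λ a → all? λ b → (C4 a b ≟ᵇ true) →-dec (c4arc a b xor c4arc b a ≟ᵇ true))

c4arc⇒C4 : ∀ a b → c4arc a b ≡ true → C4 a b ≡ true
c4arc⇒C4 a b e rewrite e = refl

C4⇒≢ : ∀ a b → C4 a b ≡ true → a ≢ b
C4⇒≢ a .a c refl = contradiction (trans (sym c) (C4-irrefl a)) λ ()

opp-involutive : ∀ a → opp (opp a) ≡ a
opp-involutive = from-yes (all? λ a → opp (opp a) ≟ a)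

C4-opp : ∀ a b → C4 a b ≡ true → C4 a (opp b) ≡ true
C4-opp = from-yes (all? λ a → all? λ b → (C4 a b ≟ᵇ true) →-dec (C4 a (opp b) ≟ᵇ true))

C4-antipodes : ∀ a b → C4 a b ≡ true → C4 (opp a) (opp b) ≡ true
C4-antipodes = from-yes (all? λ a → all? λ b → (C4 a b ≟ᵇ true) →-dec (C4 (opp a) (opp b) ≟ᵇ true))

opp≢ : ∀ a → opp a ≢ a
opp≢ = from-yes (all? λ a → ¬? (opp a ≟ a))

C4-opp-false : ∀ a → C4 (opp a) a ≡ false
C4-opp-false = from-yes (all? λ a → C4 (opp a) a ≟ᵇ false)

-- The two perfect matchings {T1T2, T3T4} and {T1T3, T2T4} of C4.
mate₁ mate₂ : Fin 4 → Fin 4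
mate₁ zero                   = suc zero
mate₁ (suc zero)             = zero
mate₁ (suc (suc zero))       = suc (suc (suc zero))
mate₁ (suc (suc (suc zero))) = suc (suc zero)
mate₂ zero                   = suc (suc zero)
mate₂ (suc zero)             = suc (suc (suc zero))
mate₂ (suc (suc zero))       = zero
mate₂ (suc (suc (suc zero))) = suc zero

C4-mates : ∀ a b → C4 a b ≡ true → b ≡ mate₁ a ⊎ b ≡ mate₂ a
C4-mates = from-yes (all? λ a → all? λ b → (C4 a b ≟ᵇ true) →-dec (b ≟ mate₁ a ⊎-dec b ≟ mate₂ a))

C4-mate₁ : ∀ a → C4 a (mate₁ a) ≡ true
C4-mate₁ = from-yes (all? λ a → C4 a (mate₁ a) ≟ᵇ true)

C4-mate₂ : ∀ a → C4 a (mate₂ a) ≡ true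
C4-mate₂ = from-yes (all? λ a → C4 a (mate₂ a) ≟ᵇ true)

mate₁-involutive : ∀ a → mate₁ (mate₁ a) ≡ a
mate₁-involutive = from-yes (all? λ a → mate₁ (mate₁ a) ≟ a)

mate₂-involutive : ∀ a → mate₂ (mate₂ a) ≡ a
mate₂-involutive = from-yes (all? λ a → mate₂ (mate₂ a) ≟ a)

mate₁∘mate₂ : ∀ a → mate₁ (mate₂ a) ≡ opp a
mate₁∘mate₂ = from-yes (all? λ a → mate₁ (mate₂ a) ≟ opp a)

mate₂∘mate₁ : ∀ a → mate₂ (mate₁ a) ≡ opp a
mate₂∘mate₁ = from-yes (all? λ a → mate₂ (mate₁ a) ≟ opp a)

mate₁≢mate₂ : ∀ a → mate₁ a ≢ mate₂ a
mate₁≢mate₂ = from-yes (all? λ a → ¬? (mate₁ a ≟ mate₂ a))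

c4arc-around : ∀ a b → C4 a b ≡ true →
               c4arc a b xor (c4arc b (opp a) xor (c4arc (opp a) (opp b) xor false)) ≡ c4arc a (opp b) xor false
c4arc-around = from-yes (all? λ a → all? λ b → (C4 a b ≟ᵇ true) →-dec
  (c4arc a b xor (c4arc b (opp a) xor (c4arc (opp a) (opp b) xor false)) ≟ᵇ c4arc a (opp b) xor false))

c4arc-across : ∀ a b → C4 a b ≡ true →
               not (c4arc a b xor (c4arc b (opp a) xor false)) ≡ c4arc a (opp b) xor (c4arc (opp b) (opp a) xor false)
c4arc-across = from-yes (all? λ a → all? λ b → (C4 a b ≟ᵇ true) →-dec
  (not (c4arc a b xor (c4arc b (opp a) xor false)) ≟ᵇ c4arc a (opp b) xor (c4arc (opp b) (opp a) xor false)))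

c4arc-odd : ∀ a b → C4 a b ≡ true →
            c4arc a b xor (c4arc b (opp a) xor (c4arc (opp a) (opp b) xor (c4arc (opp b) a xor false))) ≡ true
c4arc-odd = from-yes (all? λ a → all? λ b → (C4 a b ≟ᵇ true) →-dec
  (c4arc a b xor (c4arc b (opp a) xor (c4arc (opp a) (opp b) xor (c4arc (opp b) a xor false))) ≟ᵇ true))

-- The product C4 × T

module Product {n} {T : Graph (Fin n)} {Te : Orientation (Fin n)}
               (simple : IsSimple T) (ori : IsOrientation T Te) where

  open IsSimple simple renaming (sym to T-sym; irrefl to T-irrefl)
  open IsOrientation ori renaming (arc⇒edge to Te⇒T; edge⇒one to Te-one)

  V : Set
  V = Fin 4 × Fin n

  -- Kept opaque: unfolded into their Boolean formulas, C4× T and orientD would block the inference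
  -- of implicit vertices from adjacency proofs.
  opaque
    G : Graph V
    G = C4× T

    D : Orientation V
    D = orientD Te

  Te-irrefl : ∀ x → Te x x ≡ false
  Te-irrefl x with Te x x in e
  ... | false = refl
  ... | true  = trans (sym (Te⇒T x x e)) (T-irrefl x)

  copyOrient-irrefl : ∀ a x → copyOrient Te a x x ≡ false
  copyOrient-irrefl zero                   x = Te-irrefl x
  copyOrient-irrefl (suc zero)             x = Te-irrefl x
  copyOrient-irrefl (suc (suc zero))       x = Te-irrefl x
  copyOrient-irrefl (suc (suc (suc zero))) x = Te-irrefl x

  copyOrient⇒T : ∀ a x y → copyOrient Te a x y ≡ true → T x y ≡ true
  copyOrient⇒T zero                   x y e = Te⇒T x y e
  copyOrient⇒T (suc zero)             x y e = trans (T-sym x y) (Te⇒T y x e)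
  copyOrient⇒T (suc (suc zero))       x y e = trans (T-sym x y) (Te⇒T y x e)
  copyOrient⇒T (suc (suc (suc zero))) x y e = Te⇒T x y e

  copyOrient-one : ∀ a x y → T x y ≡ true → copyOrient Te a x y xor copyOrient Te a y x ≡ true
  copyOrient-one zero                   x y t = Te-one x y t
  copyOrient-one (suc zero)             x y t = trans (xor-comm (Te y x) (Te x y)) (Te-one x y t)
  copyOrient-one (suc (suc zero))       x y t = trans (xor-comm (Te y x) (Te x y)) (Te-one x y t)
  copyOrient-one (suc (suc (suc zero))) x y t = Te-one x y t

  copyOrient-opp : ∀ a x y → copyOrient Te (opp a) x y ≡ copyOrient Te a x y
  copyOrient-opp zero                   x y = refl
  copyOrient-opp (suc zero)             x y = refl
  copyOrient-opp (suc (suc zero))       x y = refl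
  copyOrient-opp (suc (suc (suc zero))) x y = refl

  copyOrient-adjacent : ∀ a b → C4 a b ≡ true → ∀ x y → copyOrient Te b x y ≡ copyOrient Te a y x
  copyOrient-adjacent zero                   zero                   ()
  copyOrient-adjacent zero                   (suc zero)             _ x y = refl
  copyOrient-adjacent zero                   (suc (suc zero))       _ x y = refl
  copyOrient-adjacent zero                   (suc (suc (suc zero))) ()
  copyOrient-adjacent (suc zero)             zero                   _ x y = refl
  copyOrient-adjacent (suc zero)             (suc zero)             ()
  copyOrient-adjacent (suc zero)             (suc (suc zero))       ()
  copyOrient-adjacent (suc zero)             (suc (suc (suc zero))) _ x y = refl
  copyOrient-adjacent (suc (suc zero))       zero                   _ x y = refl
  copyOrient-adjacent (suc (suc zero))       (suc zero)             ()
  copyOrient-adjacent (suc (suc zero))       (suc (suc zero))       ()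
  copyOrient-adjacent (suc (suc zero))       (suc (suc (suc zero))) _ x y = refl
  copyOrient-adjacent (suc (suc (suc zero))) zero                   ()
  copyOrient-adjacent (suc (suc (suc zero))) (suc zero)             _ x y = refl
  copyOrient-adjacent (suc (suc (suc zero))) (suc (suc zero))       _ x y = refl
  copyOrient-adjacent (suc (suc (suc zero))) (suc (suc (suc zero))) ()

  opaque
    unfolding G

    G-cases : ∀ a b x y → G (a , x) (b , y) ≡ true → (C4 a b ≡ true × x ≡ y) ⊎ (a ≡ b × T x y ≡ true)
    G-cases a b x y g with ∧-∨-true g
    ... | inj₁ (c , e) = inj₁ (c , does-true {x = x} {y} e)
    ... | inj₂ (e , t) = inj₂ (does-true {x = a} {b} e , t)

    rung : ∀ a b x → C4 a b ≡ true → G (a , x) (b , x) ≡ true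
    rung a b x c rewrite c | dec-true (x ≟ x) refl = refl

    tree : ∀ a x y → T x y ≡ true → G (a , x) (a , y) ≡ true
    tree a x y t rewrite C4-irrefl a | dec-true (a ≟ a) refl | t = refl

    G-sym : ∀ u v → G u v ≡ G v u
    G-sym (a , x) (b , y) = cong₂ _∨_ (cong₂ _∧_ (C4-sym a b) (does-sym x y)) (cong₂ _∧_ (does-sym a b) (T-sym x y))

  opaque
    unfolding D

    D-tree : ∀ a x y → D (a , x) (a , y) ≡ copyOrient Te a x y
    D-tree a x y rewrite dec-true (a ≟ a) refl | c4arc-irrefl a = ∨-identityʳ _

    D-rung : ∀ a b x → D (a , x) (b , x) ≡ c4arc a b
    D-rung a b x with a ≟ b
    ... | yes refl rewrite copyOrient-irrefl a x | c4arc-irrefl a = refl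
    ... | no _ rewrite dec-true (x ≟ x) refl = ∧-identityʳ _

    D-cases : ∀ a b x y → D (a , x) (b , y) ≡ true → (a ≡ b × copyOrient Te a x y ≡ true) ⊎ (c4arc a b ≡ true × x ≡ y)
    D-cases a b x y d with ∧-∨-true d
    ... | inj₁ (e , o) = inj₁ (does-true {x = a} {b} e , o)
    ... | inj₂ (c , e) = inj₂ (c , does-true {x = x} {y} e)

  D-one : ∀ u v → G u v ≡ true → D u v xor D v u ≡ true
  D-one (a , x) (b , y) g with G-cases a b x y g
  ... | inj₁ (c , refl) rewrite D-rung a b x | D-rung b a x = c4arc-one a b c
  ... | inj₂ (refl , t) rewrite D-tree a x y | D-tree a y x = copyOrient-one a x y t

  D⇒G : ∀ u v → D u v ≡ true → G u v ≡ true
  D⇒G (a , x) (b , y) d with D-cases a b x y d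
  ... | inj₁ (refl , o) = tree a x y (copyOrient⇒T a x y o)
  ... | inj₂ (c , refl) = rung a b x (c4arc⇒C4 a b c)

  D-orientation : IsOrientation G D
  D-orientation = record { arc⇒edge = D⇒G ; edge⇒one = D-one }

  G-diagonal : ∀ a b x y → a ≢ b → x ≢ y → G (a , x) (b , y) ≢ true
  G-diagonal a b x y a≢b x≢y g with G-cases a b x y g
  ... | inj₁ (_ , x≡y) = x≢y x≡y
  ... | inj₂ (a≡b , _) = a≢b a≡b

  rung⁻ : ∀ a b x → G (a , x) (b , x) ≡ true → C4 a b ≡ true
  rung⁻ a b x g with G-cases a b x x g
  ... | inj₁ (C , _) = C
  ... | inj₂ (_ , t) = contradiction (trans (sym t) (T-irrefl x)) λ ()

  G-irrefl : ∀ v → G v v ≢ true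
  G-irrefl (a , x) g with G-cases a a x x g
  ... | inj₁ (C , _) = contradiction (trans (sym C) (C4-irrefl a)) λ ()
  ... | inj₂ (_ , t) = contradiction (trans (sym t) (T-irrefl x)) λ ()

  open Walks {G = G}

  D-reverse : ∀ u v → G u v ≡ true → D v u ≡ not (D u v)
  D-reverse u v g = xor-true (D-one u v g)

  back-and-forth-odd : ∀ {u v} (g : G u v ≡ true) (h : G v u ≡ true) → parity D (step g (step h here)) ≡ true
  back-and-forth-odd {u} {v} g h rewrite D-reverse u v g = odd (D u v)
    where
    odd : ∀ p → p xor (not p xor false) ≡ true
    odd true  = refl
    odd false = refl

  detour : ∀ {a b x y} (g₀ : G (a , x) (a , y) ≡ true) (f : Walk G (a , y) (b , y)) (g : G (b , y) (b , x) ≡ true) →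
           parity D (step g₀ (f ++ᵂ step g here)) ≡ parity D f xor (copyOrient Te a x y xor copyOrient Te b y x)
  detour {a} {b} {x} {y} g₀ f g rewrite parity-++ D f (step g here) | D-tree a x y | D-tree b y x =
    solve 3 (λ t p t' → t ⊕ (p ⊕ (t' ⊕ id)) ⊜ p ⊕ (t ⊕ t')) refl (copyOrient Te a x y) (parity D f) (copyOrient Te b y x)

  detour-adjacent : ∀ {a b x y} → C4 a b ≡ true → (g₀ : G (a , x) (a , y) ≡ true) (f : Walk G (a , y) (b , y))
                    (g : G (b , y) (b , x) ≡ true) → parity D (step g₀ (f ++ᵂ step g here)) ≡ parity D f
  detour-adjacent {a} {b} {x} {y} Cab g₀ f g = begin
    parity D (step g₀ (f ++ᵂ step g here))                      ≡⟨ detour g₀ f g ⟩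
    parity D f xor (copyOrient Te a x y xor copyOrient Te b y x) ≡⟨ cong (λ t → parity D f xor (copyOrient Te a x y xor t))
                                                                          (copyOrient-adjacent a b Cab y x) ⟩
    parity D f xor (copyOrient Te a x y xor copyOrient Te a x y) ≡⟨ cong (parity D f xor_) (xor-same (copyOrient Te a x y)) ⟩
    parity D f xor false                                         ≡⟨ xor-identityʳ _ ⟩
    parity D f                                                   ∎
    where open ≡-Reasoning

  detour-opposite : ∀ {a x y} → T x y ≡ true → (g₀ : G (a , x) (a , y) ≡ true) (f : Walk G (a , y) (opp a , y))
                    (g : G (opp a , y) (opp a , x) ≡ true) → parity D (step g₀ (f ++ᵂ step g here)) ≡ not (parity D f)
  detour-opposite {a} {x} {y} Txy g₀ f g = begin
    parity D (step g₀ (f ++ᵂ step g here))                          ≡⟨ detour g₀ f g ⟩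
    parity D f xor (copyOrient Te a x y xor copyOrient Te (opp a) y x) ≡⟨ cong (λ t → parity D f xor (copyOrient Te a x y xor t))
                                                                              (copyOrient-opp a y x) ⟩
    parity D f xor (copyOrient Te a x y xor copyOrient Te a y x)     ≡⟨ cong (parity D f xor_) (copyOrient-one a x y Txy) ⟩
    parity D f xor true                                              ≡⟨ xor-comm (parity D f) true ⟩
    not (parity D f)                                                 ∎
    where open ≡-Reasoning

  side-parity : ∀ {a b x y} → C4 a b ≡ true → (g₀ : G (a , x) (a , y) ≡ true) (g₁ : G (a , y) (b , y) ≡ true)
                (g₂ : G (b , y) (b , x) ≡ true) (h : G (a , x) (b , x) ≡ true) →
                parity D (step g₀ (step g₁ (step g₂ here))) ≡ parity D (step h here)
  side-parity {a} {b} {x} {y} Cab g₀ g₁ g₂ h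
    rewrite detour-adjacent Cab g₀ (step g₁ here) g₂ | D-rung a b x | D-rung a b y = refl

  around-parity : ∀ {a b x y} → C4 a b ≡ true → (g₀ : G (a , x) (a , y) ≡ true) (g₁ : G (a , y) (b , y) ≡ true)
                  (g₂ : G (b , y) (opp a , y) ≡ true) (g₃ : G (opp a , y) (opp b , y) ≡ true)
                  (g₄ : G (opp b , y) (opp b , x) ≡ true) (h : G (a , x) (opp b , x) ≡ true) →
                  parity D (step g₀ (step g₁ (step g₂ (step g₃ (step g₄ here))))) ≡ parity D (step h here)
  around-parity {a} {b} {x} {y} Cab g₀ g₁ g₂ g₃ g₄ h
    rewrite detour-adjacent (C4-opp a b Cab) g₀ (step g₁ (step g₂ (step g₃ here))) g₄
          | D-rung a b y | D-rung b (opp a) y | D-rung (opp a) (opp b) y | D-rung a (opp b) x = c4arc-around a b Cab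

  across-parity : ∀ {a b x y} → T x y ≡ true → C4 a b ≡ true → (g₀ : G (a , x) (a , y) ≡ true)
                  (g₁ : G (a , y) (b , y) ≡ true) (g₂ : G (b , y) (opp a , y) ≡ true) (g₃ : G (opp a , y) (opp a , x) ≡ true)
                  (h₁ : G (a , x) (opp b , x) ≡ true) (h₂ : G (opp b , x) (opp a , x) ≡ true) →
                  parity D (step g₀ (step g₁ (step g₂ (step g₃ here)))) ≡ parity D (step h₁ (step h₂ here))
  across-parity {a} {b} {x} {y} Txy Cab g₀ g₁ g₂ g₃ h₁ h₂
    rewrite detour-opposite Txy g₀ (step g₁ (step g₂ here)) g₃
          | D-rung a b y | D-rung b (opp a) y | D-rung a (opp b) x | D-rung (opp b) (opp a) x = c4arc-across a b Cab

  fiber-square-odd : ∀ {a b y} → C4 a b ≡ true → (g₁ : G (a , y) (b , y) ≡ true) (g₂ : G (b , y) (opp a , y) ≡ true)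
                     (g₃ : G (opp a , y) (opp b , y) ≡ true) (g₄ : G (opp b , y) (a , y) ≡ true) →
                     parity D (step g₁ (step g₂ (step g₃ (step g₄ here)))) ≡ true
  fiber-square-odd {a} {b} {y} Cab g₁ g₂ g₃ g₄
    rewrite D-rung a b y | D-rung b (opp a) y | D-rung (opp a) (opp b) y | D-rung (opp b) a y = c4arc-odd a b Cab

  Region : Set
  Region = Fin n → Bool

  InRegion : Region → V → Set
  InRegion A v = A (proj₂ v) ≡ true

  OnlyNeighbourIn : Region → Fin n → Fin n → Set
  OnlyNeighbourIn A y x = ∀ {z} → A z ≡ true → T y z ≡ true → z ≡ x

  _≟ᵛ_ : DecidableEquality V
  _≟ᵛ_ = ≡-dec _≟_ _≟_

  open Matchings G-sym _≟ᵛ_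
  open import Data.List.Relation.Binary.Permutation.Setoid (setoid V) using (_↭_; ↭-trans; ↭-reflexive)
  open import Data.List.Relation.Binary.Permutation.Setoid.Properties (setoid V)
    using (++-comm; Unique-resp-↭; All-resp-↭; xs↭ys⇒|xs|≡|ys|)

  -- Cycles of length 2 are allowed: the surgery below may shrink a cycle to an edge and back.
  record RegionCycle (A : Region) : Set where
    constructor cycle
    field
      {start second} : V
      first    : G start second ≡ true
      rest     : Walk G second start
      distinct : Unique (vertices (step first rest))
      inside   : All (InRegion A) (vertices (step first rest))
      partner  : V → V
      matching : IsPerfectMatchingOn G (Free (InRegion A) (vertices (step first rest))) partner

    walk : Walk G start start
    walk = step first rest

    size : ℕ
    size = length (vertices rest)

  open RegionCycle

  rotate : ∀ {A} {P : Pred V 0ℓ} (P? : Decidable P) (c : RegionCycle A) →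
           Any P (vertices (walk c)) → Any (λ v → ¬ P v) (vertices (walk c)) →
           Σ (RegionCycle A) λ c′ → ¬ P (start c′) × P (second c′) × size c′ ≡ size c ×
                                    parity D (walk c′) ≡ parity D (walk c)
  rotate P? c P∈ ¬P∈ with crossing-closed P? (walk c) P∈ ¬P∈
  ... | record { before = b ; edge = e ; after = a ; ¬Pfrom = ¬Pf ; Pto = Pt ; split = split } =
    cycle e (a ++ᵂ b) (Unique-resp-↭ perm (distinct c)) (All-resp-↭ (λ { refl R → R }) perm (inside c))
          (partner c) (matching-resp-↭ perm (matching c)) ,
    ¬Pf , Pt , suc-injective (sym (xs↭ys⇒|xs|≡|ys| perm)) , parity-eq
    where
    perm : vertices (walk c) ↭ vertices (step e (a ++ᵂ b))
    perm = ↭-trans (↭-reflexive (trans (cong vertices (sym split)) (vertices-++ b (step e a))))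
                   (↭-trans (++-comm (vertices b) (vertices (step e a))) (↭-reflexive (cong (_ ∷_) (sym (vertices-++ a b)))))
    parity-eq : parity D (step e (a ++ᵂ b)) ≡ parity D (walk c)
    parity-eq = begin
      parity D (step e (a ++ᵂ b))                   ≡⟨ cong (D _ _ xor_) (parity-++ D a b) ⟩
      D _ _ xor (parity D a xor parity D b)         ≡⟨ solve 3 (λ d p q → d ⊕ (p ⊕ q) ⊜ q ⊕ (d ⊕ p)) refl
                                                             (D _ _) (parity D a) (parity D b) ⟩
      parity D b xor (D _ _ xor parity D a)         ≡⟨ sym (parity-++ D b (step e a)) ⟩
      parity D (b ++ᵂ step e a)                     ≡⟨ cong (parity D) split ⟩
      parity D (walk c)                             ∎
      where open ≡-Reasoning

  Shortcut : ∀ {A} → RegionCycle A → Set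
  Shortcut {A} c = Σ (RegionCycle A) λ c′ → size c′ < size c × parity D (walk c′) ≡ parity D (walk c)

  -- Excursions into the fiber over a leaf

  module LeafFiber {A : Region} {x y : Fin n} (only : OnlyNeighbourIn A y x) (Txy : T x y ≡ true) where

    x≢y : x ≢ y
    x≢y refl = contradiction (trans (sym Txy) (T-irrefl x)) λ ()

    step-from-fiber : ∀ b v → G (b , y) v ≡ true → InRegion A v → (∃ λ c → v ≡ (c , y) × C4 b c ≡ true) ⊎ v ≡ (b , x)
    step-from-fiber b (c , z) g Az with G-cases b c y z g
    ... | inj₁ (C , refl) = inj₁ (c , refl , C)
    ... | inj₂ (refl , t) rewrite only Az t = inj₂ refl

    data Excursion : ∀ {a} → Walk G (a , y) (a , x) → Set where
      back   : ∀ {a} (g : G (a , y) (a , x) ≡ true) → Excursion (step g here)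
      side   : ∀ {a b} → C4 a b ≡ true → (g₁ : G (a , y) (b , y) ≡ true) (g₂ : G (b , y) (b , x) ≡ true)
               (r : Walk G (b , x) (a , x)) → Excursion (step g₁ (step g₂ r))
      across : ∀ {a b} → C4 a b ≡ true → (g₁ : G (a , y) (b , y) ≡ true) (g₂ : G (b , y) (opp a , y) ≡ true)
               (g₃ : G (opp a , y) (opp a , x) ≡ true) (r : Walk G (opp a , x) (a , x)) →
               Excursion (step g₁ (step g₂ (step g₃ r)))
      around : ∀ {a b} → C4 a b ≡ true → (g₁ : G (a , y) (b , y) ≡ true) (g₂ : G (b , y) (opp a , y) ≡ true)
               (g₃ : G (opp a , y) (opp b , y) ≡ true) (g₄ : G (opp b , y) (opp b , x) ≡ true)
               (r : Walk G (opp b , x) (a , x)) → Excursion (step g₁ (step g₂ (step g₃ (step g₄ r))))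

    after-three-rungs : ∀ {a b v} → C4 a b ≡ true →
                        (g₁ : G (a , y) (b , y) ≡ true) (g₂ : G (b , y) (opp a , y) ≡ true)
                        (g₃ : G (opp a , y) (opp b , y) ≡ true) (g₄ : G (opp b , y) v ≡ true) (r : Walk G v (a , x)) →
                        Unique ((a , x) ∷ (a , y) ∷ (b , y) ∷ (opp a , y) ∷ (opp b , y) ∷ vertices r) →
                        All (InRegion A) ((a , x) ∷ (a , y) ∷ (b , y) ∷ (opp a , y) ∷ (opp b , y) ∷ vertices r) →
                        Excursion (step g₁ (step g₂ (step g₃ (step g₄ r))))
    after-three-rungs {a} {b} Cab g₁ g₂ g₃ g₄ here _ _ =
      contradiction g₄ (G-diagonal (opp b) a y x (λ ob≡a → C4⇒≢ a (opp b) (C4-opp a b Cab) (sym ob≡a)) (x≢y ∘ sym))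
    after-three-rungs {a} {b} {v} Cab g₁ g₂ g₃ g₄ (step g₅ r) uniq (_ ∷ _ ∷ _ ∷ _ ∷ _ ∷ Rv ∷ _)
      with step-from-fiber (opp b) v g₄ Rv
    ... | inj₂ refl = around Cab g₁ g₂ g₃ g₄ (step g₅ r)
    ... | inj₁ (e , refl , C) with e ≟ opp a
    ...   | yes refl = ⊥-elim (repeated-not-unique ((a , x) ∷ (a , y) ∷ (b , y) ∷ []) ((opp b , y) ∷ []) uniq)
    ...   | no e≢oa with trans (C4-other (opp a) (opp b) e (rung⁻ (opp a) (opp b) y g₃) C e≢oa) (opp-involutive a)
    ...     | refl = ⊥-elim (repeated-not-unique ((a , x) ∷ []) ((b , y) ∷ (opp a , y) ∷ (opp b , y) ∷ []) uniq)

    after-two-rungs : ∀ {a b v} → C4 a b ≡ true →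
                      (g₁ : G (a , y) (b , y) ≡ true) (g₂ : G (b , y) (opp a , y) ≡ true)
                      (g₃ : G (opp a , y) v ≡ true) (r : Walk G v (a , x)) →
                      Unique ((a , x) ∷ (a , y) ∷ (b , y) ∷ (opp a , y) ∷ vertices r) →
                      All (InRegion A) ((a , x) ∷ (a , y) ∷ (b , y) ∷ (opp a , y) ∷ vertices r) →
                      Excursion (step g₁ (step g₂ (step g₃ r)))
    after-two-rungs {a} Cab g₁ g₂ g₃ here _ _ =
      contradiction g₃ (G-diagonal (opp a) a y x (opp≢ a) (x≢y ∘ sym))
    after-two-rungs {a} {b} {v} Cab g₁ g₂ g₃ (step g₄ r) uniq inside@(_ ∷ _ ∷ _ ∷ _ ∷ Rv ∷ _)
      with step-from-fiber (opp a) v g₃ Rv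
    ... | inj₂ refl = across Cab g₁ g₂ g₃ (step g₄ r)
    ... | inj₁ (d , refl , C) with d ≟ b
    ...   | yes refl = ⊥-elim (repeated-not-unique ((a , x) ∷ (a , y) ∷ []) ((opp a , y) ∷ []) uniq)
    ...   | no d≢b with C4-other b (opp a) d (rung⁻ b (opp a) y g₂) C d≢b
    ...     | refl = after-three-rungs Cab g₁ g₂ g₃ g₄ r uniq inside

    after-rung : ∀ {a b v} → C4 a b ≡ true →
                 (g₁ : G (a , y) (b , y) ≡ true) (g₂ : G (b , y) v ≡ true) (r : Walk G v (a , x)) →
                 Unique ((a , x) ∷ (a , y) ∷ (b , y) ∷ vertices r) →
                 All (InRegion A) ((a , x) ∷ (a , y) ∷ (b , y) ∷ vertices r) →
                 Excursion (step g₁ (step g₂ r))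
    after-rung {a} {b} Cab g₁ g₂ here _ _ =
      contradiction g₂ (G-diagonal b a y x (C4⇒≢ b a (trans (C4-sym b a) Cab)) (x≢y ∘ sym))
    after-rung {a} {b} {v} Cab g₁ g₂ (step g₃ r) uniq inside@(_ ∷ _ ∷ _ ∷ Rv ∷ _) with step-from-fiber b v g₂ Rv
    ... | inj₂ refl = side Cab g₁ g₂ (step g₃ r)
    ... | inj₁ (c , refl , C) with c ≟ a
    ...   | yes refl = ⊥-elim (repeated-not-unique ((a , x) ∷ []) ((b , y) ∷ []) uniq)
    ...   | no c≢a with C4-other a b c Cab C c≢a
    ...     | refl = after-two-rungs Cab g₁ g₂ g₃ r uniq inside

    excursion : ∀ {a v} (g₁ : G (a , y) v ≡ true) (r : Walk G v (a , x)) →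
                Unique ((a , x) ∷ (a , y) ∷ vertices r) → All (InRegion A) ((a , x) ∷ (a , y) ∷ vertices r) →
                Excursion (step g₁ r)
    excursion g₁ here _ _ = back g₁
    excursion {a} {v} g₁ (step g₂ r) uniq inside@(_ ∷ _ ∷ Rv ∷ _) with step-from-fiber a v g₁ Rv
    ... | inj₂ refl = ⊥-elim (repeated-not-unique [] ((a , y) ∷ []) uniq)
    ... | inj₁ (b , refl , Cab) = after-rung Cab g₁ g₂ r uniq inside

    -- The other neighbours (a , y) and (opp a , y) of (opp b , y) in the fiber lie on the cycle.
    fourth-corner : ∀ {a b μ} → C4 a b ≡ true → (r : Walk G (opp a , x) (a , x)) →
                    let old = (a , x) ∷ (a , y) ∷ (b , y) ∷ (opp a , y) ∷ vertices r in
                    Unique old → All (InRegion A) old → IsPerfectMatchingOn G (Free (InRegion A) old) μ →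
                    (opp b , y) ∉ old × μ (opp b , y) ≡ (opp b , x)
    fourth-corner {a} {b} {μ} Cab r (_ ∷ (_ ∷ _ ∷ ay∉r) ∷ _ ∷ cy∉r ∷ distinct-r) (_ ∷ Ray ∷ _ ∷ _ ∷ inside-r) m =
      dy∉old , μdy≡dx
      where
      d = opp b
      Cad : C4 a d ≡ true
      Cad = C4-opp a b Cab
      x≢y′ : ∀ {c e} → (c , x) ≢ (e , y)
      x≢y′ e = x≢y (cong proj₂ e)
      corner-neighbour : ∀ w → InRegion A w → G (d , y) w ≡ true → w ≡ (a , y) ⊎ w ≡ (opp a , y) ⊎ w ≡ (d , x)
      corner-neighbour w Rw g with step-from-fiber d w g Rw
      ... | inj₂ w≡dx = inj₂ (inj₂ w≡dx)
      ... | inj₁ (c , refl , Cdc) with c ≟ a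
      ...   | yes refl = inj₁ refl
      ...   | no c≢a   = inj₂ (inj₁ (cong (_, y) (C4-other a d c Cad Cdc c≢a)))
      on-r-neighbour : ∀ {w} → w ∈ vertices r → G (d , y) w ≡ true → w ≡ (d , x)
      on-r-neighbour {w} w∈r g with corner-neighbour w (All.lookup inside-r w∈r) g
      ... | inj₁ refl        = ⊥-elim (All¬⇒¬Any ay∉r w∈r)
      ... | inj₂ (inj₁ refl) = ⊥-elim (All¬⇒¬Any cy∉r w∈r)
      ... | inj₂ (inj₂ w≡dx) = w≡dx
      dy∉r : (d , y) ∉ vertices r
      dy∉r dy∈r with neighbours-on-walk r distinct-r dy∈r (x≢y′ ∘ sym)
      ... | p , q , p∈r , gp , gq , inj₂ refl = G-diagonal d a y x (λ d≡a → C4⇒≢ a d Cad (sym d≡a)) (x≢y ∘ sym) gq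
      ... | p , q , p∈r , gp , gq , inj₁ (q∈r , p≢q) =
        p≢q (trans (on-r-neighbour p∈r (trans (G-sym (d , y) p) gp)) (sym (on-r-neighbour q∈r gq)))
      dy∉old : (d , y) ∉ (a , x) ∷ (a , y) ∷ (b , y) ∷ (opp a , y) ∷ vertices r
      dy∉old (here e)                           = x≢y′ (sym e)
      dy∉old (there (here e))                   = C4⇒≢ a d Cad (sym (cong proj₁ e))
      dy∉old (there (there (here e)))           = opp≢ b (cong proj₁ e)
      dy∉old (there (there (there (here e))))   = C4⇒≢ (opp a) d (C4-antipodes a b Cab) (sym (cong proj₁ e))
      dy∉old (there (there (there (there e)))) = dy∉r e
      μdy≡dx : μ (d , y) ≡ (d , x)
      μdy≡dx with m (d , y) (Ray , dy∉old)
      ... | (Rμ , μ∉) , g , _ with corner-neighbour (μ (d , y)) Rμ g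
      ...   | inj₁ e        = ⊥-elim (μ∉ (there (here e)))
      ...   | inj₂ (inj₁ e) = ⊥-elim (μ∉ (there (there (there (here e)))))
      ...   | inj₂ (inj₂ e) = e

    side-shortcut : ∀ {a b} (Cab : C4 a b ≡ true) (g₀ : G (a , x) (a , y) ≡ true) (g₁ : G (a , y) (b , y) ≡ true)
                    (g₂ : G (b , y) (b , x) ≡ true) (r : Walk G (b , x) (a , x)) distinct inside μ m →
                    Shortcut (cycle {A = A} g₀ (step g₁ (step g₂ r)) distinct inside μ m)
    side-shortcut {a} {b} Cab g₀ g₁ g₂ r distinct (Rax ∷ Ray ∷ Rby ∷ Rr) μ m =
      cycle h r (Unique-drop [ ax ] (Unique-drop [ ax ] distinct)) (Rax ∷ Rr)
            (pair-up (a , y) (b , y) μ) (uncover {R = InRegion A} [ ax ] distinct Ray Rby g₁ m) ,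
      m<n⇒m<1+n (n<1+n _) ,
      parity-prefix D (step h here) (step g₀ (step g₁ (step g₂ here))) r (sym (side-parity Cab g₀ g₁ g₂ h))
      where
      ax = (a , x)
      h = rung a b x Cab

    around-shortcut : ∀ {a b} (Cab : C4 a b ≡ true) (g₀ : G (a , x) (a , y) ≡ true) (g₁ : G (a , y) (b , y) ≡ true)
                      (g₂ : G (b , y) (opp a , y) ≡ true) (g₃ : G (opp a , y) (opp b , y) ≡ true)
                      (g₄ : G (opp b , y) (opp b , x) ≡ true) (r : Walk G (opp b , x) (a , x)) distinct inside μ m →
                      Shortcut (cycle {A = A} g₀ (step g₁ (step g₂ (step g₃ (step g₄ r)))) distinct inside μ m)
    around-shortcut {a} {b} Cab g₀ g₁ g₂ g₃ g₄ r distinct (Rax ∷ Ray ∷ Rby ∷ Rcy ∷ Rdy ∷ Rr) μ m =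
      cycle h r (drop-pair (drop-pair distinct)) (Rax ∷ Rr) (pair-up (opp a , y) (opp b , y) (pair-up (a , y) (b , y) μ))
            (uncover {R = InRegion A} [ ax ] (drop-pair distinct) Rcy Rdy g₃
              (uncover {R = InRegion A} [ ax ] distinct Ray Rby g₁ m)) ,
      m<n⇒m<1+n (m<n⇒m<1+n (m<n⇒m<1+n (n<1+n _))) ,
      parity-prefix D (step h here) (step g₀ (step g₁ (step g₂ (step g₃ (step g₄ here))))) r
                    (sym (around-parity Cab g₀ g₁ g₂ g₃ g₄ h))
      where
      ax = (a , x)
      h = rung a (opp b) x (C4-opp a b Cab)
      drop-pair : ∀ {p q l} → Unique (ax ∷ p ∷ q ∷ l) → Unique (ax ∷ l)
      drop-pair = Unique-drop [ ax ] ∘ Unique-drop [ ax ]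

    across-shortcut : ∀ {a b} (Cab : C4 a b ≡ true) (g₀ : G (a , x) (a , y) ≡ true) (g₁ : G (a , y) (b , y) ≡ true)
                      (g₂ : G (b , y) (opp a , y) ≡ true) (g₃ : G (opp a , y) (opp a , x) ≡ true)
                      (r : Walk G (opp a , x) (a , x)) distinct inside μ m →
                      Shortcut (cycle {A = A} g₀ (step g₁ (step g₂ (step g₃ r))) distinct inside μ m)
    across-shortcut {a} {b} Cab g₀ g₁ g₂ g₃ r distinct inside@(Rax ∷ Ray ∷ Rby ∷ Rcy ∷ Rr) μ m =
      cycle h₁ (step h₂ r) (drop-pair (drop-pair U)) (Rax ∷ Rax ∷ Rr) (pair-up cy dy (pair-up ay by μ))
            (uncover {R = InRegion A} [ ax ] (drop-pair U) Rcy Ray (rung (opp a) d y (C4-antipodes a b Cab))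
              (uncover {R = InRegion A} [ ax ] U Ray Rby g₁ m′)) ,
      m<n⇒m<1+n (n<1+n _) ,
      parity-prefix D (step h₁ (step h₂ here)) (step g₀ (step g₁ (step g₂ (step g₃ here)))) r
                    (sym (across-parity Txy Cab g₀ g₁ g₂ g₃ h₁ h₂))
      where
      d = opp b
      ax = (a , x)
      ay = (a , y)
      by = (b , y)
      cy = (opp a , y)
      dy = (d , y)
      dx = (d , x)
      old = ax ∷ ay ∷ by ∷ cy ∷ vertices r
      h₁ = rung a d x (C4-opp a b Cab)
      h₂ = rung d (opp a) x (C4-antipodes b a (trans (C4-sym b a) Cab))
      corner : dy ∉ old × μ dy ≡ dx
      corner = fourth-corner Cab r distinct inside m
      dx∉old : dx ∉ old
      dx∉old with m dy (Ray , proj₁ corner)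
      ... | (_ , μdy∉) , _ = subst (_∉ old) (proj₂ corner) μdy∉
      U : Unique (ax ∷ ay ∷ by ∷ cy ∷ dy ∷ dx ∷ vertices r)
      U = Unique-insert (ax ∷ ay ∷ by ∷ cy ∷ [])
            (∉-insert (ax ∷ ay ∷ by ∷ cy ∷ []) (proj₁ corner) (λ e → x≢y (sym (cong proj₂ e))))
                        (Unique-insert (ax ∷ ay ∷ by ∷ cy ∷ []) dx∉old distinct)
      m′ : IsPerfectMatchingOn G (Free (InRegion A) (ax ∷ ay ∷ by ∷ cy ∷ dy ∷ dx ∷ vertices r)) μ
      m′ = subst (λ v → IsPerfectMatchingOn G (Free (InRegion A) (ax ∷ ay ∷ by ∷ cy ∷ dy ∷ v ∷ vertices r)) μ) (proj₂ corner)
                 (cover {R = InRegion A} (ax ∷ ay ∷ by ∷ cy ∷ []) m (Ray , proj₁ corner))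
      drop-pair : ∀ {p q l} → Unique (ax ∷ p ∷ q ∷ l) → Unique (ax ∷ l)
      drop-pair = Unique-drop [ ax ] ∘ Unique-drop [ ax ]

    shortcut : ∀ {a} (g₀ : G (a , x) (a , y) ≡ true) {r : Walk G (a , y) (a , x)} → Excursion r → ∀ distinct inside μ m →
               parity D (step g₀ r) ≡ true ⊎ Shortcut (cycle {A = A} g₀ r distinct inside μ m)
    shortcut g₀ (back g)                        _ _ _ _ = inj₁ (back-and-forth-odd g₀ g)
    shortcut g₀ (side Cab g₁ g₂ r)              d i μ m = inj₂ (side-shortcut Cab g₀ g₁ g₂ r d i μ m)
    shortcut g₀ (across Cab g₁ g₂ g₃ r)         d i μ m = inj₂ (across-shortcut Cab g₀ g₁ g₂ g₃ r d i μ m)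
    shortcut g₀ (around Cab g₁ g₂ g₃ g₄ r)      d i μ m = inj₂ (around-shortcut Cab g₀ g₁ g₂ g₃ g₄ r d i μ m)

  fiber-cycle-odd : ∀ {a y v} (g₁ : G (a , y) v ≡ true) (r : Walk G v (a , y)) →
                    Unique ((a , y) ∷ vertices r) → All (λ w → proj₂ w ≡ y) (vertices r) → parity D (step g₁ r) ≡ true
  fiber-cycle-odd {a} {y} g₁ here _ _ = ⊥-elim (G-irrefl (a , y) g₁)
  fiber-cycle-odd {a} {y} {b , .y} g₁ (step g₂ here) _ (refl ∷ _) = back-and-forth-odd g₁ g₂
  fiber-cycle-odd {a} {y} {b , .y} g₁ (step {w = c , .y} g₂ (step g₃ r)) uniq (refl ∷ refl ∷ in-fiber) with c ≟ a
  ... | yes refl = ⊥-elim (repeated-not-unique [] ((b , y) ∷ []) uniq)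
  ... | no c≢a with C4-other a b c (rung⁻ a b y g₁) (rung⁻ b c y g₂) c≢a
  ...   | refl = around-fiber g₃ r uniq in-fiber
    where
    Cab = rung⁻ a b y g₁
    around-fiber : ∀ {v} (g₃ : G (opp a , y) v ≡ true) (r : Walk G v (a , y)) →
                   Unique ((a , y) ∷ (b , y) ∷ (opp a , y) ∷ vertices r) → All (λ w → proj₂ w ≡ y) (vertices r) →
                   parity D (step g₁ (step g₂ (step g₃ r))) ≡ true
    around-fiber g₃ here _ _ = contradiction (trans (sym (rung⁻ (opp a) a y g₃)) (C4-opp-false a)) λ ()
    around-fiber {d , .y} g₃ (step g₄ r) uniq (refl ∷ in-fiber) with d ≟ b
    ... | yes refl = ⊥-elim (repeated-not-unique ((a , y) ∷ []) ((opp a , y) ∷ []) uniq)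
    ... | no d≢b with C4-other b (opp a) d (rung⁻ b (opp a) y g₂) (rung⁻ (opp a) d y g₃) d≢b
    ...   | refl = closing g₄ r uniq in-fiber
      where
      closing : ∀ {v} (g₄ : G (opp b , y) v ≡ true) (r : Walk G v (a , y)) →
                Unique ((a , y) ∷ (b , y) ∷ (opp a , y) ∷ (opp b , y) ∷ vertices r) → All (λ w → proj₂ w ≡ y) (vertices r) →
                parity D (step g₁ (step g₂ (step g₃ (step g₄ r)))) ≡ true
      closing g₄ here _ _ = fiber-square-odd Cab g₁ g₂ g₃ g₄
      closing {e , .y} g₄ (step g₅ r) uniq (refl ∷ _) with e ≟ opp a
      ... | yes refl = ⊥-elim (repeated-not-unique ((a , y) ∷ (b , y) ∷ []) ((opp b , y) ∷ []) uniq)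
      ... | no e≢oa
        with trans (C4-other (opp a) (opp b) e (rung⁻ (opp a) (opp b) y g₃) (rung⁻ (opp b) e y g₄) e≢oa) (opp-involutive a)
      ...   | refl = ⊥-elim (repeated-not-unique [] ((b , y) ∷ (opp a , y) ∷ (opp b , y) ∷ []) uniq)

  infixl 6 _─_
  _─_ : Region → Fin n → Region
  (A ─ y) z = A z ∧ not (does (z ≟ y))

  ─⁻ : ∀ {A y z} → (A ─ y) z ≡ true → A z ≡ true × z ≢ y
  ─⁻ {A} {y} {z} e with A z | z ≟ y
  ... | true | no z≢y = refl , z≢y

  ─⁺ : ∀ {A y z} → A z ≡ true → z ≢ y → (A ─ y) z ≡ true
  ─⁺ {y = y} {z} Az z≢y rewrite Az | dec-false (z ≟ y) z≢y = refl

  count-─ : ∀ {A y} → A y ≡ true → count (A ─ y) < count A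
  count-─ {A} {y} Ay = count-mono-< (λ i → proj₁ ∘ ─⁻ {A} {y} {i}) y removed Ay
    where
    removed : (A ─ y) y ≡ false
    removed rewrite dec-true (y ≟ y) refl = ∧-zeroʳ (A y)

  module Relinking {A : Region} {y : Fin n} {l : List V} {μ : V → V} (Ay : A y ≡ true) (leaf : LeafIn T A y)
                   (avoids : ∀ {v} → v ∈ l → proj₂ v ≢ y) (m : IsPerfectMatchingOn G (Free (InRegion A) l) μ) where

    Exits : Fin n → Fin 4 → Set
    Exits z k = μ (k , y) ≡ (k , z)

    partner-copy : Fin n → Fin 4 → Fin 4
    partner-copy z k = if does (μ (mate₁ k , y) ≟ᵛ (mate₁ k , z)) then mate₁ k else mate₂ k

    relink : V → V
    relink (k , z) with μ (k , z) ≟ᵛ (k , y)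
    ... | yes _ = (partner-copy z k , z)
    ... | no _  = μ (k , z)

    private
      free-y : ∀ j → Free (InRegion A) l (j , y)
      free-y j = Ay , λ j∈ → avoids j∈ refl

      μ-involutive : ∀ {j c} → μ (j , y) ≡ (c , y) → μ (c , y) ≡ (j , y)
      μ-involutive {j} e = trans (cong μ (sym e)) (proj₂ (proj₂ (m (j , y) (free-y j))))

      partner-exits : ∀ {z k} → Exits z (mate₁ k) → partner-copy z k ≡ mate₁ k
      partner-exits {z} {k} e rewrite dec-true (μ (mate₁ k , y) ≟ᵛ (mate₁ k , z)) e = refl

      partner-stays : ∀ {z k} → ¬ Exits z (mate₁ k) → partner-copy z k ≡ mate₂ k
      partner-stays {z} {k} ¬e rewrite dec-false (μ (mate₁ k , y) ≟ᵛ (mate₁ k , z)) ¬e = refl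

      relink-exits : ∀ {k z} → μ (k , z) ≡ (k , y) → relink (k , z) ≡ (partner-copy z k , z)
      relink-exits {k} {z} e with μ (k , z) ≟ᵛ (k , y)
      ... | yes _ = refl
      ... | no ¬e = contradiction e ¬e

      relink-stays : ∀ {k z} → μ (k , z) ≢ (k , y) → relink (k , z) ≡ μ (k , z)
      relink-stays {k} {z} ¬e with μ (k , z) ≟ᵛ (k , y)
      ... | yes e = contradiction e ¬e
      ... | no _  = refl

    pairing : ∀ {z} → A z ≡ true → T z y ≡ true → ∀ {k} → Exits z k →
              C4 k (partner-copy z k) ≡ true × Exits z (partner-copy z k) × partner-copy z (partner-copy z k) ≡ k
    pairing {z} Az Tzy {k} ek with μ (mate₁ k , y) ≟ᵛ (mate₁ k , z)
    ... | yes e₁ =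
      C4-mate₁ k , e₁ , trans (partner-exits (subst (Exits z) (sym (mate₁-involutive k)) ek)) (mate₁-involutive k)
    ... | no ¬e₁ = C4-mate₂ k , e₂ , trans (partner-stays ¬e-opp) (mate₂-involutive k)
      where
      only : OnlyNeighbourIn A y z
      only Az′ Tyz′ = leaf _ z Az′ Az Tyz′ (trans (T-sym y z) Tzy)
      open LeafFiber only Tzy using (step-from-fiber) renaming (x≢y to z≢y)
      z≢y′ : ∀ {a b} → (a , z) ≢ (b , y)
      z≢y′ e = z≢y (cong proj₂ e)
      options : ∀ j → (∃ λ c → μ (j , y) ≡ (c , y) × C4 j c ≡ true) ⊎ Exits z j
      options j with m (j , y) (free-y j)
      ... | (Rj , _) , gj , _ = step-from-fiber j (μ (j , y)) gj Rj
      μ₁ : μ (mate₁ k , y) ≡ (opp k , y)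
      μ₁ with options (mate₁ k)
      ... | inj₂ e = ⊥-elim (¬e₁ e)
      ... | inj₁ (c , e , C) with C4-mates (mate₁ k) c C
      ...   | inj₁ refl =
        ⊥-elim (z≢y′ (trans (sym ek) (subst (λ j → μ (j , y) ≡ (mate₁ k , y)) (mate₁-involutive k) (μ-involutive e))))
      ...   | inj₂ refl = trans e (cong (_, y) (mate₂∘mate₁ k))
      μ-opp : μ (opp k , y) ≡ (mate₁ k , y)
      μ-opp = μ-involutive μ₁
      e₂ : Exits z (mate₂ k)
      e₂ with options (mate₂ k)
      ... | inj₂ e = e
      ... | inj₁ (c , e , C) with C4-mates (mate₂ k) c C
      ...   | inj₁ refl = ⊥-elim (mate₁≢mate₂ k (cong proj₁ (trans (sym μ-opp)
                            (subst (λ j → μ (j , y) ≡ (mate₂ k , y)) (mate₁∘mate₂ k) (μ-involutive e)))))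
      ...   | inj₂ refl =
        ⊥-elim (z≢y′ (trans (sym ek) (subst (λ j → μ (j , y) ≡ (mate₂ k , y)) (mate₂-involutive k) (μ-involutive e))))
      ¬e-opp : ¬ Exits z (mate₁ (mate₂ k))
      ¬e-opp e rewrite mate₁∘mate₂ k = z≢y′ (trans (sym e) μ-opp)

    relinked : IsPerfectMatchingOn G (Free (InRegion (A ─ y)) l) relink
    relinked (k , z) (R─z , v∉) with ─⁻ {A} R─z
    ... | Az , z≢y with m (k , z) (Az , v∉) | μ (k , z) ≟ᵛ (k , y)
    ...   | (Rμ , μ∉) , g , inv | no ¬e = (─⁺ {A} Rμ stays , μ∉) , g , trans (relink-stays returns) inv
      where
      stays : proj₂ (μ (k , z)) ≢ y
      stays e with G-cases k (proj₁ (μ (k , z))) z (proj₂ (μ (k , z))) g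
      ... | inj₁ (_ , z≡) = z≢y (trans z≡ e)
      ... | inj₂ (k≡ , _) = ¬e (cong₂ _,_ (sym k≡) e)
      returns : μ (μ (k , z)) ≢ (proj₁ (μ (k , z)) , y)
      returns e = z≢y (cong proj₂ (trans (sym inv) e))
    ...   | (Rμ , μ∉) , g , inv | yes e with G-cases k k z y (subst (λ v → G (k , z) v ≡ true) e g)
    ...     | inj₁ (_ , z≡y) = ⊥-elim (z≢y z≡y)
    ...     | inj₂ (_ , Tzy) with pairing Az Tzy (trans (cong μ (sym e)) inv)
    ...       | Ckp , ep , pp = (─⁺ {A} Az z≢y , p-free) , rung k p z Ckp , trans (relink-exits p-returns) (cong (_, z) pp)
      where
      p = partner-copy z k
      p-matched = m (p , y) (free-y p)
      p-free : (p , z) ∉ l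
      p-free = subst (_∉ l) ep (proj₂ (proj₁ p-matched))
      p-returns : μ (p , z) ≡ (p , y)
      p-returns = trans (cong μ (sym ep)) (proj₂ (proj₂ p-matched))

  entering-shortcut : ∀ {A y} → LeafIn T A y → (c : RegionCycle A) → proj₂ (start c) ≢ y → proj₂ (second c) ≡ y →
                      parity D (walk c) ≡ true ⊎ Shortcut c
  entering-shortcut {A} {y} leaf (cycle {a , x} {a′ , y′} g r distinct inside μ m) x≢y refl with G-cases a a′ x y g | r
  ... | inj₁ (_ , x≡y)    | _          = ⊥-elim (x≢y x≡y)
  ... | inj₂ (refl , Txy) | here       = ⊥-elim (x≢y refl)
  ... | inj₂ (refl , Txy) | step g₁ r₁ = shortcut g (excursion g₁ r₁ distinct inside) distinct inside μ m
    where
    only : OnlyNeighbourIn A y x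
    only Az Tyz = leaf _ x Az (All.head inside) Tyz (trans (T-sym y x) Txy)
    open LeafFiber only Txy

  fiber-odd : ∀ {A y} (c : RegionCycle A) → All (λ v → proj₂ v ≡ y) (vertices (walk c)) → parity D (walk c) ≡ true
  fiber-odd (cycle g r distinct _ _ _) (refl ∷ within) = fiber-cycle-odd g r distinct within

  odd-or-shorter : ∀ {A y} → LeafIn T A y → (c : RegionCycle A) →
                   Any (λ v → proj₂ v ≡ y) (vertices (walk c)) → Any (λ v → proj₂ v ≢ y) (vertices (walk c)) →
                   parity D (walk c) ≡ true ⊎ Shortcut c
  odd-or-shorter {y = y} leaf c meets leaves = through (rotate (λ v → proj₂ v ≟ y) c meets leaves)
    where
    through : (Σ (RegionCycle _) λ c′ → proj₂ (start c′) ≢ y × proj₂ (second c′) ≡ y × size c′ ≡ size c ×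
                                        parity D (walk c′) ≡ parity D (walk c)) →
              parity D (walk c) ≡ true ⊎ Shortcut c
    through (c′ , ¬Py , Py , size≡ , parity≡) with entering-shortcut leaf c′ ¬Py Py
    ... | inj₁ odd = inj₁ (trans (sym parity≡) odd)
    ... | inj₂ (c″ , shorter , parity≡′) = inj₂ (c″ , subst (size c″ <_) size≡ shorter , trans parity≡′ parity≡)

  -- The induction on regions

  module _ (C : Cycle G) where

    private
      K = 2 + Cycle.k C

      inner-adj : ∀ j → G (vtx C (inject₁ j)) (vtx C (suc j)) ≡ true
      inner-adj j = subst (λ i → G (vtx C (inject₁ j)) (vtx C i) ≡ true) (next-inject₁ j) (adj C (inject₁ j))

      last-adj : G (vtx C (fromℕ K)) (vtx C zero) ≡ true
      last-adj = subst (λ i → G (vtx C (fromℕ K)) (vtx C i) ≡ true) (next-fromℕ K) (adj C (fromℕ K))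

    closed-walk : Walk G (vtx C zero) (vtx C zero)
    closed-walk = path (vtx C) inner-adj last-adj

    closed-walk-parity : parity D closed-walk ≡ sum (λ i → D (vtx C i) (vtx C (next i)))
    closed-walk-parity = parity-path D (vtx C) inner-adj last-adj (λ i → D (vtx C i) (vtx C (next i)))
                                     (λ j → cong (λ i → D (vtx C (inject₁ j)) (vtx C i)) (next-inject₁ j))
                                     (cong (λ i → D (vtx C (fromℕ K)) (vtx C i)) (next-fromℕ K))

    nice-region-cycle : Nice C → RegionCycle (λ _ → true)
    nice-region-cycle (μ , m) =
      cycle (inner-adj zero) (path (λ i → vtx C (suc i)) (λ j → inner-adj (suc j)) last-adj)
            (subst Unique (sym vertices≡) (tabulate⁺ (λ {i} {j} → inj C i j))) (All.universal (λ _ → refl) _) μ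
            (matching-resp (λ (_ , v∉) → v∉ ∘ OnC⇒∈) (λ v∉C → refl , v∉C ∘ ∈⇒OnC) m)
      where
      vertices≡ : vertices closed-walk ≡ tabulate (vtx C)
      vertices≡ = vertices-path (vtx C) inner-adj last-adj
      ∈⇒OnC : ∀ {v} → v ∈ vertices closed-walk → OnC C v
      ∈⇒OnC {v} v∈ with ∈-tabulate⁻ {f = vtx C} (subst (v ∈_) vertices≡ v∈)
      ... | i , v≡ = i , sym v≡
      OnC⇒∈ : ∀ {v} → OnC C v → v ∈ vertices closed-walk
      OnC⇒∈ (i , refl) = subst (vtx C i ∈_) (sym vertices≡) (∈-tabulate⁺ {f = vtx C} i)

  module _ (acyclic : Cycle T → ⊥) where

    region-cycle-odd : ∀ N {A} (c : RegionCycle A) → count A + size c < N → parity D (walk c) ≡ true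
    region-cycle-odd (suc N) {A} c bound with leaf-exists T-irrefl acyclic A (All.head (inside c))
    ... | y , Ay , leaf with Any.any? (λ v → proj₂ v ≟ y) (vertices (walk c))
    ...   | no avoids = region-cycle-odd N (cycle (first c) (rest c) (distinct c) inside′ relink relinked)
                          (<-≤-trans (+-monoˡ-< (size c) (count-─ Ay)) (≤-pred bound))
      where
      avoid : ∀ {v} → v ∈ vertices (walk c) → proj₂ v ≢ y
      avoid v∈ e = avoids (Any.map (λ { refl → e }) v∈)
      inside′ : All (InRegion (A ─ y)) (vertices (walk c))
      inside′ = All.tabulate (λ v∈ → ─⁺ {A} (All.lookup (inside c) v∈) (avoid v∈))
      open Relinking Ay leaf avoid (matching c)
    ...   | yes meets with All.all? (λ v → proj₂ v ≟ y) (vertices (walk c))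
    ...     | yes within = fiber-odd c within
    ...     | no ¬within = finish (odd-or-shorter leaf c meets (¬All⇒Any¬ (λ v → proj₂ v ≟ y) (vertices (walk c)) ¬within))
      where
      finish : parity D (walk c) ≡ true ⊎ Shortcut c → parity D (walk c) ≡ true
      finish (inj₁ odd) = odd
      finish (inj₂ (c′ , shorter , parity≡)) =
        trans (sym parity≡) (region-cycle-odd N c′ (<-≤-trans (+-monoʳ-< (count A) shorter) (≤-pred bound)))

    pfaffian : IsPfaffian G D
    pfaffian = record { orientation = D-orientation ; oddly = oddly-oriented }
      where
      oddly-oriented : (C : Cycle G) → EvenCycle C → Nice C → OddlyOriented D C
      oddly-oriented C even nice = odd-count forward-arc forward , odd-count (λ i → D (vtx C (next i)) (vtx C i)) backward
        where
        forward-arc : Fin (len C) → Bool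
        forward-arc i = D (vtx C i) (vtx C (next i))
        forward : sum forward-arc ≡ true
        forward = trans (sym (closed-walk-parity C)) (region-cycle-odd _ (nice-region-cycle C nice) (n<1+n _))
        backward : sum (λ i → D (vtx C (next i)) (vtx C i)) ≡ true
        backward = trans (sum-cong-≗ (λ i → D-reverse (vtx C i) (vtx C (next i)) (adj C i)))
                         (trans (sum-not even forward-arc) forward)

  opaque
    unfolding G

    pfaffian-C4×T : (Cycle T → ⊥) → IsPfaffian (C4× T) (orientD Te)
    pfaffian-C4×T = pfaffian

theorem6 : (n : ℕ) (T : Graph (Fin n)) (Te : Orientation (Fin n)) →
    IsTree T → IsOrientation T Te → IsPfaffian (C4× T) (orientD Te)
theorem6 n T Te tree ori = Product.pfaffian-C4×T (IsTree.simple tree) ori (IsTree.acyclic tree)
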